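{- Let $p\ge5$ be a prime, $k$ a positive integer, and $\mathsf{A}=\prod_{i=1}^r\mathsf{A}_i$ a finite product of local commutative $\mathbb{F}_p$-algebras. Let $s=\frac{p-1}{(k-1,p-1)}$ and let $H$ be a subgroup of $\mathrm{GL}_2(\mathbb{F}_p)$ with $|H|>2s$ such that the determinant maps $H$ surjectively onto $(\mathbb{F}_p^\times)^{k-1}$. Then the normal closure of $H$ in $\widehat G(\mathsf{A})$ is $\widehat G(\mathsf{A})$ itself.
   Context: $\widehat G(\mathsf{A})=\{\gamma\in\mathrm{GL}_2(\mathsf{A}) : \det\gamma\in(\mathbb{F}_p^\times)^{k-1}\}$, where $\mathbb{F}_p\subseteq\mathsf{A}$ via the algebra structure and $(\mathbb{F}_p^\times)^{k-1}$ is the subgroup of $(k-1)$-th powers. $\mathrm{GL}_2(\mathbb{F}_p)$ is viewed as a subgroup of $\mathrm{GL}_2(\mathsf{A})$. -}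

module Defs where

open import Level using (Level; _⊔_)
open import Data.Nat as ℕ using (ℕ; zero; suc)
open import Data.Integer as ℤ using (ℤ; +_; -[1+_])
open import Data.Integer.Divisibility using () renaming (_∣_ to _∣ℤ_)
open import Data.Fin using (Fin)
open import Data.Product using (Σ; _×_; ∃; ∃-syntax)
open import Data.Sum using (_⊎_)
open import Relation.Nullary using (¬_)
open import Algebra.Bundles using (CommutativeRing)
open import Algebra.Bundles.Raw using (RawRing)

module _ {c ℓ} (R : RawRing c ℓ) where
  open RawRing R

  natCast : ℕ → Carrier
  natCast zero    = 0#
  natCast (suc n) = 1# + natCast n

  intCast : ℤ → Carrier
  intCast (+ n)      = natCast n
  intCast -[1+ n ]   = - natCast (suc n)

  pow : Carrier → ℕ → Carrier
  pow x zero    = 1#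
  pow x (suc n) = x * pow x n

  IsUnit : Carrier → Set (c ⊔ ℓ)
  IsUnit x = ∃[ y ] (x * y ≈ 1#)

record M2 {c} (A : Set c) : Set c where
  constructor mat
  field
    a b c' d : A

module _ {c ℓ} (R : RawRing c ℓ) where
  open RawRing R
  open M2

  _≈M_ : M2 Carrier → M2 Carrier → Set ℓ
  M ≈M N = (a M ≈ a N) × (b M ≈ b N) × (c' M ≈ c' N) × (d M ≈ d N)

  _·M_ : M2 Carrier → M2 Carrier → M2 Carrier
  M ·M N = mat (a M * a N + b M * c' N) (a M * b N + b M * d N)
               (c' M * a N + d M * c' N) (c' M * b N + d M * d N)

  IM : M2 Carrier
  IM = mat 1# 0# 0# 1#

  det : M2 Carrier → Carrier
  det M = a M * d M + - (b M * c' M)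

  InverseOf : M2 Carrier → M2 Carrier → Set ℓ
  InverseOf N M = ((M ·M N) ≈M IM) × ((N ·M M) ≈M IM)

  InGL2 : M2 Carrier → Set (c ⊔ ℓ)
  InGL2 M = ∃[ N ] InverseOf N M

mapM2 : ∀ {a b} {A : Set a} {B : Set b} → (A → B) → M2 A → M2 B
mapM2 f (mat x y z w) = mat (f x) (f y) (f z) (f w)

-- 𝔽_p, modelled as ℤ with equality "congruent modulo p"

𝔽 : ℕ → RawRing Level.zero Level.zero
𝔽 p = record
  { Carrier = ℤ
  ; _≈_ = λ x y → (+ p) ∣ℤ (x ℤ.- y)
  ; _+_ = ℤ._+_
  ; _*_ = ℤ._*_
  ; -_ = ℤ.-_
  ; 0# = + 0
  ; 1# = + 1
  }

IsUnitModP : ℕ → ℤ → Set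
IsUnitModP p u = ¬ ((+ p) ∣ℤ u)

module _ {c ℓ} (A : CommutativeRing c ℓ) where
  open CommutativeRing A

  -- a commutative ring is local iff it is nontrivial and for every x,
  -- x or 1 - x is a unit (equivalently: the non-units form the unique
  -- maximal ideal)
  IsLocal : Set (c ⊔ ℓ)
  IsLocal = (1# ≉ 0#) × (∀ x → IsUnit rawRing x ⊎ IsUnit rawRing (1# - x))

  -- a commutative ring admits a (necessarily unique) 𝔽_p-algebra
  -- structure iff p·1 = 0 in it
  Is𝔽Algebra : ℕ → Set ℓ
  Is𝔽Algebra p = natCast rawRing p ≈ 0#

Prod : ∀ {c ℓ} (r : ℕ) → (Fin r → CommutativeRing c ℓ) → RawRing c ℓ
Prod r A = record
  { Carrier = (i : Fin r) → CommutativeRing.Carrier (A i)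
  ; _≈_ = λ x y → (i : Fin r) → CommutativeRing._≈_ (A i) (x i) (y i)
  ; _+_ = λ x y i → CommutativeRing._+_ (A i) (x i) (y i)
  ; _*_ = λ x y i → CommutativeRing._*_ (A i) (x i) (y i)
  ; -_ = λ x i → CommutativeRing.-_ (A i) (x i)
  ; 0# = λ i → CommutativeRing.0# (A i)
  ; 1# = λ i → CommutativeRing.1# (A i)
  }

module _ {c ℓ} (p k : ℕ) (R : RawRing c ℓ) where
  open RawRing R

  InGhat : M2 Carrier → Set (c ⊔ ℓ)
  InGhat γ = InGL2 R γ ×
             ∃[ u ] (IsUnitModP p u × (det R γ ≈ intCast R (u ℤ.^ (k ℕ.∸ 1))))

  embed : M2 ℤ → M2 Carrier
  embed = mapM2 (intCast R)

  data NormalClosure (H : M2 ℤ → Set) : M2 Carrier → Set (c ⊔ ℓ) where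
    conj : ∀ g g⁻¹ h → InGhat g → InverseOf R g⁻¹ g → H h →
           NormalClosure H (_·M_ R (_·M_ R g (embed h)) g⁻¹)
    one  : NormalClosure H (IM R)
    mul  : ∀ x y → NormalClosure H x → NormalClosure H y →
           NormalClosure H (_·M_ R x y)
    inv  : ∀ x y → NormalClosure H x → InverseOf R y x → NormalClosure H y
    resp : ∀ x y → NormalClosure H x → _≈M_ R x y → NormalClosure H y

-- Subgroups H ≤ GL₂(𝔽_p), given as predicates on integer matrices
-- (respecting congruence mod p)

open import Relation.Binary.PropositionalEquality using (_≡_)

record IsSubgroupGL2 (p : ℕ) (H : M2 ℤ → Set) : Set where
  field
    H-resp : ∀ x y → H x → _≈M_ (𝔽 p) x y → H y
    H-sub  : ∀ x → H x → InGL2 (𝔽 p) x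
    H-one  : H (IM (𝔽 p))
    H-mul  : ∀ x y → H x → H y → H (_·M_ (𝔽 p) x y)
    H-inv  : ∀ x → H x → ∃[ y ] (H y × InverseOf (𝔽 p) y x)

-- |H| > n : H contains n+1 pairwise distinct (mod p) elements
CardGT : (p : ℕ) → (M2 ℤ → Set) → ℕ → Set
CardGT p H n = Σ (Fin (suc n) → M2 ℤ) λ f → ((∀ (i : Fin (suc n)) → H (f i)) ×
                       (∀ i j → _≈M_ (𝔽 p) (f i) (f j) → i ≡ j))

DetOnto : (p k : ℕ) → (M2 ℤ → Set) → Set
DetOnto p k H =
  (∀ h → H h → ∃[ u ] (IsUnitModP p u × RawRing._≈_ (𝔽 p) (det (𝔽 p) h) (u ℤ.^ (k ℕ.∸ 1)))) ×
  (∀ u → IsUnitModP p u → ∃[ h ] (H h × RawRing._≈_ (𝔽 p) (det (𝔽 p) h) (u ℤ.^ (k ℕ.∸ 1))))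

-- Write N for the normal closure of H in Ĝ(A). Since det maps H onto
-- (𝔽ₚ^×)^(k-1), every γ ∈ Ĝ(A) is δ h with h ∈ H and det δ = 1, so it suffices to
-- show SL₂(A) ⊆ N; over a product of local rings, SL₂(A) is generated by the
-- elementary matrices E₁₂ x and E₂₁ x. A scalar a·I ∈ H has a² a (k-1)-th power,
-- hence a^(2s) = 1, so |H| > 2s yields a non-scalar h ∈ H, which an SL₂(𝔽ₚ)-conjugation
-- brings to top-left entry 0. Such an h conjugates E₁₂ x to E₂₁ (κ x), so N contains
-- every commutator [E₂₁ y , E₁₂ u], hence [g , E₁₂ t] for every elementary g.
-- For g = diag 2 ½ this commutator is E₁₂ (3 t); as 2 and 3 are invertible (p ≥ 5),
-- N contains all E₁₂ t, their conjugates E₂₁ t, and so all of SL₂(A).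
module Submission where

open import Algebra.Bundles using (CommutativeRing)
open import Algebra.Bundles.Raw using (RawRing)
open import Data.Nat using (ℕ)
open import Data.Nat.Primality using (Prime)
open import Data.Integer using (ℤ; +_)
open import Data.Product using (∃-syntax)
open import Data.Sum using (_⊎_)
open import Relation.Nullary using (¬_; Dec)
open import Level using (_⊔_)
open import Defs using (M2; natCast; Is𝔽Algebra; IsUnitModP; IsLocal; IsSubgroupGL2)

module M2Operations {a r} (S : RawRing a r) where
  open import Defs using (M2; mat; _·M_; IM)
  import Defs

  open RawRing S

  infixl 7 _·_

  _·_ : M2 Carrier → M2 Carrier → M2 Carrier
  _·_ = _·M_ S

  I : M2 Carrier
  I = IM S

  det : M2 Carrier → Carrier
  det = Defs.det S

  adj : M2 Carrier → M2 Carrier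
  adj (mat a b c d) = mat d (- b) (- c) a

  E₁₂ E₂₁ : Carrier → M2 Carrier
  E₁₂ x = mat 1# x 0# 1#
  E₂₁ x = mat 1# 0# x 1#

  diag antidiag : Carrier → Carrier → M2 Carrier
  diag     u v = mat u 0# 0# v
  antidiag u v = mat 0# u v 0#

  w : M2 Carrier
  w = mat 0# 1# (- 1#) 0#

  [_,_] : M2 Carrier → M2 Carrier → M2 Carrier
  [ g , x ] = g · x · adj g · adj x

module IntegerCast {c ℓ} (R : CommutativeRing c ℓ) where
  open import Data.Nat as ℕ using (ℕ; zero; suc)
  import Data.Nat.Properties as ℕ
  open import Data.Integer as ℤ using (ℤ; +_; -[1+_]; _⊖_)
  import Data.Integer.Properties as ℤ
  open import Data.Maybe using (Maybe; just; nothing)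
  open import Relation.Nullary using (yes; no)
  open import Relation.Binary.PropositionalEquality as ≡ using (_≡_)
  open import Algebra.Solver.Ring.AlmostCommutativeRing using (_-Raw-AlmostCommutative⟶_; fromCommutativeRing)
  open import Defs using (natCast; intCast)

  open CommutativeRing R
  open import Algebra.Properties.Ring ring using (-0#≈0#; -‿involutive; -‿distribˡ-*; -‿distribʳ-*; -‿+-comm)
  open import Algebra.Properties.Group +-group using (//-rightDividesʳ)
  open import Algebra.Properties.CommutativeSemigroup +-commutativeSemigroup using (x∙yz≈y∙xz)
  open import Algebra.Properties.Semiring.Mult semiring using (_×_; ×-homo-+; ×1-homo-*)
  open import Relation.Binary.Reasoning.Setoid setoid

  ι : ℤ → Carrier
  ι = intCast rawRing

  natCast≡×1 : ∀ n → natCast rawRing n ≡ n × 1#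
  natCast≡×1 zero    = ≡.refl
  natCast≡×1 (suc n) = ≡.cong (λ x → 1# + x) (natCast≡×1 n)

  natCast-+ : ∀ m n → natCast rawRing (m ℕ.+ n) ≈ natCast rawRing m + natCast rawRing n
  natCast-+ m n rewrite natCast≡×1 (m ℕ.+ n) | natCast≡×1 m | natCast≡×1 n = ×-homo-+ 1# m n

  natCast-* : ∀ m n → natCast rawRing (m ℕ.* n) ≈ natCast rawRing m * natCast rawRing n
  natCast-* m n rewrite natCast≡×1 (m ℕ.* n) | natCast≡×1 m | natCast≡×1 n = ×1-homo-* m n

  ι-⊖+ : ∀ m n → ι (m ⊖ n) + natCast rawRing n ≈ natCast rawRing m
  ι-⊖+ zero    zero    = +-identityʳ 0#
  ι-⊖+ zero    (suc n) = -‿inverseˡ _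
  ι-⊖+ (suc m) zero    = +-identityʳ _
  ι-⊖+ (suc m) (suc n) = begin
    ι (suc m ⊖ suc n) + (1# + natCast rawRing n) ≡⟨ ≡.cong (λ z → ι z + (1# + natCast rawRing n)) (ℤ.[1+m]⊖[1+n]≡m⊖n m n) ⟩
    ι (m ⊖ n) + (1# + natCast rawRing n)         ≈⟨ x∙yz≈y∙xz _ _ _ ⟩
    1# + (ι (m ⊖ n) + natCast rawRing n)         ≈⟨ +-congˡ (ι-⊖+ m n) ⟩
    1# + natCast rawRing m                       ∎

  ι-⊖ : ∀ m n → ι (m ⊖ n) ≈ natCast rawRing m - natCast rawRing n
  ι-⊖ m n = trans (sym (//-rightDividesʳ (natCast rawRing n) (ι (m ⊖ n)))) (+-congʳ (ι-⊖+ m n))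

  ι-neg : ∀ x → ι (ℤ.- x) ≈ - ι x
  ι-neg (+ zero)  = sym -0#≈0#
  ι-neg (+ suc n) = refl
  ι-neg -[1+ n ]  = sym (-‿involutive _)

  ι-+ : ∀ x y → ι (x ℤ.+ y) ≈ ι x + ι y
  ι-+ (+ m)    (+ n)    = natCast-+ m n
  ι-+ (+ m)    -[1+ n ] = ι-⊖ m (suc n)
  ι-+ -[1+ m ] (+ n)    = trans (ι-⊖ n (suc m)) (+-comm _ _)
  ι-+ -[1+ m ] -[1+ n ] = begin
    - natCast rawRing (suc (suc (m ℕ.+ n)))                ≡⟨ ≡.cong (λ z → - natCast rawRing (suc z)) (≡.sym (ℕ.+-suc m n)) ⟩
    - natCast rawRing (suc m ℕ.+ suc n)                    ≈⟨ -‿cong (natCast-+ (suc m) (suc n)) ⟩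
    - (natCast rawRing (suc m) + natCast rawRing (suc n))  ≈⟨ sym (-‿+-comm _ _) ⟩
    - natCast rawRing (suc m) - natCast rawRing (suc n)    ∎

  private
    ι-*⁺ : ∀ m y → ι (+ m ℤ.* y) ≈ natCast rawRing m * ι y
    ι-*⁺ m (+ n)    = trans (≡.subst (λ z → ι z ≈ natCast rawRing (m ℕ.* n)) (ℤ.pos-* m n) refl) (natCast-* m n)
    ι-*⁺ m -[1+ n ] = begin
      ι (+ m ℤ.* -[1+ n ])                             ≡⟨ ≡.cong ι (≡.sym (ℤ.neg-distribʳ-* (+ m) (+ suc n))) ⟩
      ι (ℤ.- (+ m ℤ.* + suc n))                        ≈⟨ ι-neg (+ m ℤ.* + suc n) ⟩
      - ι (+ m ℤ.* + suc n)                            ≈⟨ -‿cong (ι-*⁺ m (+ suc n)) ⟩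
      - (natCast rawRing m * natCast rawRing (suc n))  ≈⟨ -‿distribʳ-* _ _ ⟩
      natCast rawRing m * ι -[1+ n ]                   ∎

  ι-* : ∀ x y → ι (x ℤ.* y) ≈ ι x * ι y
  ι-* (+ m)    y = ι-*⁺ m y
  ι-* -[1+ m ] y = begin
    ι (-[1+ m ] ℤ.* y)                 ≡⟨ ≡.cong ι (≡.sym (ℤ.neg-distribˡ-* (+ suc m) y)) ⟩
    ι (ℤ.- (+ suc m ℤ.* y))            ≈⟨ ι-neg (+ suc m ℤ.* y) ⟩
    - ι (+ suc m ℤ.* y)                ≈⟨ -‿cong (ι-*⁺ (suc m) y) ⟩
    - (natCast rawRing (suc m) * ι y)  ≈⟨ -‿distribˡ-* _ _ ⟩
    ι -[1+ m ] * ι y                   ∎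

  ι-1 : ι (+ 1) ≈ 1#
  ι-1 = +-identityʳ 1#

  -- Agrees with ι up to ≈, but sends 0 and 1 to 0# and 1# on the nose, so that
  -- the solver constants con (+ 0) and con (+ 1) denote 0# and 1# definitionally.
  private
    coefficient : ℤ → Carrier
    coefficient (+ 0) = 0#
    coefficient (+ 1) = 1#
    coefficient x     = ι x

    coefficient≈ι : ∀ x → coefficient x ≈ ι x
    coefficient≈ι (+ zero)        = refl
    coefficient≈ι (+ suc zero)    = sym ι-1
    coefficient≈ι (+ suc (suc n)) = refl
    coefficient≈ι -[1+ n ]        = refl

    ℤ-coefficients : ℤ.+-*-rawRing -Raw-AlmostCommutative⟶ fromCommutativeRing R
    ℤ-coefficients = record
      { ⟦_⟧    = coefficient
      ; +-homo = λ x y → via (x ℤ.+ y) (ι-+ x y) (+-cong (coefficient≈ι x) (coefficient≈ι y))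
      ; *-homo = λ x y → via (x ℤ.* y) (ι-* x y) (*-cong (coefficient≈ι x) (coefficient≈ι y))
      ; -‿homo = λ x → via (ℤ.- x) (ι-neg x) (-‿cong (coefficient≈ι x))
      ; 0-homo = refl
      ; 1-homo = refl
      }
      where
      via : ∀ z {u v} → ι z ≈ u → v ≈ u → coefficient z ≈ v
      via z e f = trans (coefficient≈ι z) (trans e (sym f))

    coefficient? : ∀ a b → Maybe (coefficient a ≈ coefficient b)
    coefficient? a b with a ℤ.≟ b
    ... | yes ≡.refl = just refl
    ... | no _       = nothing

  open import Algebra.Solver.Ring ℤ.+-*-rawRing (fromCommutativeRing R) ℤ-coefficients coefficient? public
    using (solve; _:=_; _:+_; _:*_; :-_; _:-_; con; Polynomial)

module Matrix {c ℓ} (R : CommutativeRing c ℓ) where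
  open import Level using (0ℓ)
  open import Data.Nat using (ℕ)
  open import Data.Integer using (+_)
  open import Data.Product using (_,_)
  open import Algebra.Bundles using (Monoid)
  open import Algebra.Bundles.Raw using (RawRing)
  open import Relation.Binary.Bundles using (Setoid)
  open import Relation.Binary.Structures using (IsEquivalence)
  open import Relation.Binary.PropositionalEquality using (_≡_)
  open import Defs using (M2; mat; _·M_; _≈M_; IM; InverseOf)
  import Algebra.Solver.Monoid as MonoidSolver
  import Relation.Binary.Reasoning.Setoid
  import Defs

  open CommutativeRing R
  open import Algebra.Properties.Ring ring using (-0#≈0#)
  open IntegerCast R using (solve; _:=_; _:+_; _:*_; :-_; con; Polynomial)

  Mx : Set c
  Mx = M2 Carrier

  private module Ops = M2Operations
  open Ops rawRing public

  infix 4 _≋_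
  _≋_ : Mx → Mx → Set ℓ
  _≋_ = _≈M_ rawRing

  -- Matrices of solver polynomials multiply by the same formula as matrices over R,
  -- so an identity between explicit matrix expressions is one solver call per
  -- entry, with the expression restated through P.
  polynomials : ℕ → RawRing 0ℓ 0ℓ
  polynomials n = record
    { Carrier = Polynomial n ; _≈_ = _≡_ ; _+_ = _:+_ ; _*_ = _:*_ ; -_ = :-_
    ; 0# = con (+ 0) ; 1# = con (+ 1) }

  module P {n} = Ops (polynomials n)

  ≋-refl : ∀ {M} → M ≋ M
  ≋-refl = refl , refl , refl , refl

  ≋-sym : ∀ {M N} → M ≋ N → N ≋ M
  ≋-sym (p , q , r , s) = sym p , sym q , sym r , sym s

  ≋-trans : ∀ {M N P} → M ≋ N → N ≋ P → M ≋ P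
  ≋-trans (p , q , r , s) (p′ , q′ , r′ , s′) = trans p p′ , trans q q′ , trans r r′ , trans s s′

  ≋-isEquivalence : IsEquivalence _≋_
  ≋-isEquivalence = record { refl = ≋-refl ; sym = ≋-sym ; trans = ≋-trans }

  ≋-setoid : Setoid c ℓ
  ≋-setoid = record { isEquivalence = ≋-isEquivalence }

  ·-cong : ∀ {M M′ N N′} → M ≋ M′ → N ≋ N′ → M · N ≋ M′ · N′
  ·-cong (p , q , r , s) (p′ , q′ , r′ , s′) =
    +-cong (*-cong p p′) (*-cong q r′) , +-cong (*-cong p q′) (*-cong q s′) ,
    +-cong (*-cong r p′) (*-cong s r′) , +-cong (*-cong r q′) (*-cong s s′)

  ·-congˡ : ∀ {M N N′} → N ≋ N′ → M · N ≋ M · N′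
  ·-congˡ = ·-cong ≋-refl

  ·-congʳ : ∀ {M M′ N} → M ≋ M′ → M · N ≋ M′ · N
  ·-congʳ p = ·-cong p ≋-refl

  ·-assoc : ∀ M N P → (M · N) · P ≋ M · (N · P)
  ·-assoc (mat a b c d) (mat e f g h) (mat i j k l) =
    row a b , row′ a b , row c d , row′ c d
    where
    row : ∀ x y → (x * e + y * g) * i + (x * f + y * h) * k ≈ x * (e * i + f * k) + y * (g * i + h * k)
    row = solve 8 (λ e f g h i k x y → (x :* e :+ y :* g) :* i :+ (x :* f :+ y :* h) :* k
                                     := x :* (e :* i :+ f :* k) :+ y :* (g :* i :+ h :* k)) refl e f g h i k
    row′ : ∀ x y → (x * e + y * g) * j + (x * f + y * h) * l ≈ x * (e * j + f * l) + y * (g * j + h * l)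
    row′ = solve 8 (λ e f g h j l x y → (x :* e :+ y :* g) :* j :+ (x :* f :+ y :* h) :* l
                                      := x :* (e :* j :+ f :* l) :+ y :* (g :* j :+ h :* l)) refl e f g h j l

  ·-identityˡ : ∀ M → I · M ≋ M
  ·-identityˡ (mat a b c d) = entry a c , entry b d , entry′ a c , entry′ b d
    where
    entry : ∀ x y → 1# * x + 0# * y ≈ x
    entry = solve 2 (λ x y → con (+ 1) :* x :+ con (+ 0) :* y := x) refl
    entry′ : ∀ x y → 0# * x + 1# * y ≈ y
    entry′ = solve 2 (λ x y → con (+ 0) :* x :+ con (+ 1) :* y := y) refl

  ·-identityʳ : ∀ M → M · I ≋ M
  ·-identityʳ (mat a b c d) = entry a b , entry′ a b , entry c d , entry′ c d
    where
    entry : ∀ x y → x * 1# + y * 0# ≈ x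
    entry = solve 2 (λ x y → x :* con (+ 1) :+ y :* con (+ 0) := x) refl
    entry′ : ∀ x y → x * 0# + y * 1# ≈ y
    entry′ = solve 2 (λ x y → x :* con (+ 0) :+ y :* con (+ 1) := y) refl

  ·-monoid : Monoid c ℓ
  ·-monoid = record
    { _∙_ = _·_ ; ε = I
    ; isMonoid = record
      { isSemigroup = record
        { isMagma = record { isEquivalence = ≋-isEquivalence ; ∙-cong = ·-cong }
        ; assoc = ·-assoc }
      ; identity = ·-identityˡ , ·-identityʳ } }

  adj-cong : ∀ {M N} → M ≋ N → adj M ≋ adj N
  adj-cong (p , q , r , s) = s , -‿cong q , -‿cong r , p

  det-cong : ∀ {M N} → M ≋ N → det M ≈ det N
  det-cong (p , q , r , s) = +-cong (*-cong p s) (-‿cong (*-cong q r))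

  det-· : ∀ M N → det (M · N) ≈ det M * det N
  det-· (mat a b c d) (mat e f g h) =
    solve 8 (λ a b c d e f g h → P.det (mat a b c d P.· mat e f g h) := P.det (mat a b c d) :* P.det (mat e f g h))
      refl a b c d e f g h

  det-I : det I ≈ 1#
  det-I = solve 0 (P.det P.I := con (+ 1)) refl

  det-inverse : ∀ {M N} → M · N ≋ I → det M * det N ≈ 1#
  det-inverse {M} {N} MN≋I = trans (sym (det-· M N)) (trans (det-cong MN≋I) det-I)

  adj-· : ∀ M N → adj (M · N) ≋ adj N · adj M
  adj-· (mat a b c d) (mat e f g h) =
    solve 8 (λ a b c d e f g h → M2.a (P.adj (mat a b c d P.· mat e f g h)) := M2.a (P.adj (mat e f g h) P.· P.adj (mat a b c d))) refl a b c d e f g h ,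
    solve 8 (λ a b c d e f g h → M2.b (P.adj (mat a b c d P.· mat e f g h)) := M2.b (P.adj (mat e f g h) P.· P.adj (mat a b c d))) refl a b c d e f g h ,
    solve 8 (λ a b c d e f g h → M2.c' (P.adj (mat a b c d P.· mat e f g h)) := M2.c' (P.adj (mat e f g h) P.· P.adj (mat a b c d))) refl a b c d e f g h ,
    solve 8 (λ a b c d e f g h → M2.d (P.adj (mat a b c d P.· mat e f g h)) := M2.d (P.adj (mat e f g h) P.· P.adj (mat a b c d))) refl a b c d e f g h

  adj-inverseʳ : ∀ M → det M ≈ 1# → M · adj M ≋ I
  adj-inverseʳ (mat a b c d) det≈1 =
    trans (solve 4 (λ a b c d → M2.a (mat a b c d P.· P.adj (mat a b c d)) := P.det (mat a b c d)) refl a b c d) det≈1 ,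
    solve 4 (λ a b c d → M2.b (mat a b c d P.· P.adj (mat a b c d)) := con (+ 0)) refl a b c d ,
    solve 4 (λ a b c d → M2.c' (mat a b c d P.· P.adj (mat a b c d)) := con (+ 0)) refl a b c d ,
    trans (solve 4 (λ a b c d → M2.d (mat a b c d P.· P.adj (mat a b c d)) := P.det (mat a b c d)) refl a b c d) det≈1

  adj-inverseˡ : ∀ M → det M ≈ 1# → adj M · M ≋ I
  adj-inverseˡ (mat a b c d) det≈1 =
    trans (solve 4 (λ a b c d → M2.a (P.adj (mat a b c d) P.· mat a b c d) := P.det (mat a b c d)) refl a b c d) det≈1 ,
    solve 4 (λ a b c d → M2.b (P.adj (mat a b c d) P.· mat a b c d) := con (+ 0)) refl a b c d ,
    solve 4 (λ a b c d → M2.c' (P.adj (mat a b c d) P.· mat a b c d) := con (+ 0)) refl a b c d ,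
    trans (solve 4 (λ a b c d → M2.d (P.adj (mat a b c d) P.· mat a b c d) := P.det (mat a b c d)) refl a b c d) det≈1

  adj-inverse : ∀ M → det M ≈ 1# → InverseOf rawRing (adj M) M
  adj-inverse M det≈1 = adj-inverseʳ M det≈1 , adj-inverseˡ M det≈1

  det-E₁₂ : ∀ x → det (E₁₂ x) ≈ 1#
  det-E₁₂ = solve 1 (λ x → P.det (P.E₁₂ x) := con (+ 1)) refl

  det-E₂₁ : ∀ x → det (E₂₁ x) ≈ 1#
  det-E₂₁ = solve 1 (λ x → P.det (P.E₂₁ x) := con (+ 1)) refl

  det-w : det w ≈ 1#
  det-w = solve 0 (P.det P.w := con (+ 1)) refl

  E₁₂-cong : ∀ {x y} → x ≈ y → E₁₂ x ≋ E₁₂ y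
  E₁₂-cong x≈y = refl , x≈y , refl , refl

  E₂₁-cong : ∀ {x y} → x ≈ y → E₂₁ x ≋ E₂₁ y
  E₂₁-cong x≈y = refl , refl , x≈y , refl

  E₁₂-+ : ∀ x y → E₁₂ x · E₁₂ y ≋ E₁₂ (x + y)
  E₁₂-+ x y =
    solve 2 (λ x y → M2.a (P.E₁₂ x P.· P.E₁₂ y) := con (+ 1)) refl x y ,
    solve 2 (λ x y → M2.b (P.E₁₂ x P.· P.E₁₂ y) := x :+ y) refl x y ,
    solve 2 (λ x y → M2.c' (P.E₁₂ x P.· P.E₁₂ y) := con (+ 0)) refl x y ,
    solve 2 (λ x y → M2.d (P.E₁₂ x P.· P.E₁₂ y) := con (+ 1)) refl x y

  adj-E₁₂ : ∀ x → adj (E₁₂ x) ≋ E₁₂ (- x)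
  adj-E₁₂ x = refl , refl , -0#≈0# , refl

  adj-E₂₁ : ∀ x → adj (E₂₁ x) ≋ E₂₁ (- x)
  adj-E₂₁ x = refl , -0#≈0# , refl , refl

  module ·-Solver = MonoidSolver ·-monoid
  open ·-Solver using (Expr)
  open ·-Solver public using (_⊜_)

  -- the solver's own _⊕_ associates to the right, unlike _·_
  infixl 7 _⊙_
  _⊙_ : ∀ {n} → Expr n → Expr n → Expr n
  _⊙_ = ·-Solver._⊕_
  module ≋-Reasoning = Relation.Binary.Reasoning.Setoid ≋-setoid

  cancel-inner : ∀ {u v} → u · v ≋ I → ∀ x y → x · u · v · y ≋ x · y
  cancel-inner {u} {v} uv≋I x y = begin
    x · u · v · y   ≈⟨ ·-Solver.solve 4 (λ x u v y → x ⊙ u ⊙ v ⊙ y ⊜ x ⊙ (u ⊙ v) ⊙ y) ≋-refl x u v y ⟩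
    x · (u · v) · y ≈⟨ ·-congʳ (·-congˡ uv≋I) ⟩
    x · I · y       ≈⟨ ·-congʳ (·-identityʳ x) ⟩
    x · y           ∎
    where open ≋-Reasoning

  inverse-· : ∀ {x x′ y y′} → InverseOf rawRing x′ x → InverseOf rawRing y′ y → InverseOf rawRing (y′ · x′) (x · y)
  inverse-· {x} {x′} {y} {y′} (xx′≋I , x′x≋I) (yy′≋I , y′y≋I) =
    (begin
      x · y · (y′ · x′) ≈⟨ ·-Solver.solve 4 (λ x y y′ x′ → x ⊙ y ⊙ (y′ ⊙ x′) ⊜ x ⊙ y ⊙ y′ ⊙ x′) ≋-refl x y y′ x′ ⟩
      x · y · y′ · x′   ≈⟨ cancel-inner yy′≋I x x′ ⟩
      x · x′            ≈⟨ xx′≋I ⟩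
      I                 ∎) ,
    (begin
      y′ · x′ · (x · y) ≈⟨ ·-Solver.solve 4 (λ y′ x′ x y → y′ ⊙ x′ ⊙ (x ⊙ y) ⊜ y′ ⊙ x′ ⊙ x ⊙ y) ≋-refl y′ x′ x y ⟩
      y′ · x′ · x · y   ≈⟨ cancel-inner x′x≋I y′ y ⟩
      y′ · y            ≈⟨ y′y≋I ⟩
      I                 ∎)
    where open ≋-Reasoning

  module _ {g} (det≈1 : det g ≈ 1#) where

    conj-· : ∀ x y → (g · x · adj g) · (g · y · adj g) ≋ g · (x · y) · adj g
    conj-· x y = begin
      (g · x · adj g) · (g · y · adj g) ≈⟨ ·-Solver.solve 4 (λ g x g′ y → g ⊙ x ⊙ g′ ⊙ (g ⊙ y ⊙ g′) ⊜ g ⊙ x ⊙ g′ ⊙ g ⊙ (y ⊙ g′))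
                                             ≋-refl g x (adj g) y ⟩
      g · x · adj g · g · (y · adj g)   ≈⟨ cancel-inner (adj-inverseˡ g det≈1) (g · x) (y · adj g) ⟩
      g · x · (y · adj g)               ≈⟨ ·-Solver.solve 4 (λ g x y g′ → g ⊙ x ⊙ (y ⊙ g′) ⊜ g ⊙ (x ⊙ y) ⊙ g′) ≋-refl g x y (adj g) ⟩
      g · (x · y) · adj g               ∎
      where open ≋-Reasoning

    conj-I : g · I · adj g ≋ I
    conj-I = ≋-trans (·-congʳ (·-identityʳ g)) (adj-inverseʳ g det≈1)

    conj-inverse : ∀ {x y} → InverseOf rawRing y x → InverseOf rawRing (g · y · adj g) (g · x · adj g)
    conj-inverse {x} {y} (xy≋I , yx≋I) =
      ≋-trans (conj-· x y) (≋-trans (conj-cong xy≋I) conj-I) ,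
      ≋-trans (conj-· y x) (≋-trans (conj-cong yx≋I) conj-I)
      where
      conj-cong : ∀ {x y} → x ≋ y → g · x · adj g ≋ g · y · adj g
      conj-cong x≋y = ·-congʳ (·-congˡ x≋y)

  conj-conj : ∀ g g′ x → g · g′ · x · adj (g · g′) ≋ g · (g′ · x · adj g′) · adj g
  conj-conj g g′ x = begin
    g · g′ · x · adj (g · g′)      ≈⟨ ·-congˡ (adj-· g g′) ⟩
    g · g′ · x · (adj g′ · adj g)  ≈⟨ ·-Solver.solve 5 (λ g g′ x G′ G → g ⊙ g′ ⊙ x ⊙ (G′ ⊙ G) ⊜ g ⊙ (g′ ⊙ x ⊙ G′) ⊙ G) ≋-refl g g′ x (adj g′) (adj g) ⟩
    g · (g′ · x · adj g′) · adj g  ∎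
    where open ≋-Reasoning

module ElementaryMatrices {c ℓ} (R : CommutativeRing c ℓ) where
  open import Data.Integer using (+_)
  open import Data.Product using (∃-syntax; _×_; _,_)
  open import Defs using (M2; mat)

  open CommutativeRing R
  open IntegerCast R using (solve; _:=_; _:+_; _:*_; :-_; _:-_; con)
  open Matrix R
  import Relation.Binary.Reasoning.Setoid as ≈-Reasoning

  infixl 7 _∙_
  data Elementary : Mx → Set c where
    upper : ∀ x → Elementary (E₁₂ x)
    lower : ∀ x → Elementary (E₂₁ x)
    _∙_   : ∀ {g g′} → Elementary g → Elementary g′ → Elementary (g · g′)

  elementary-det : ∀ {g} → Elementary g → det g ≈ 1#
  elementary-det (upper x) = det-E₁₂ x
  elementary-det (lower x) = det-E₂₁ x
  elementary-det (e ∙ e′)  = trans (det-· _ _) (trans (*-cong (elementary-det e) (elementary-det e′)) (*-identityˡ 1#))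

  E₁₂E₂₁E₁₂≋antidiag : ∀ {u v} → u * v ≈ 1# → E₁₂ u · E₂₁ (- v) · E₁₂ u ≋ antidiag u (- v)
  E₁₂E₂₁E₁₂≋antidiag {u} {v} uv≈1 =
    (begin
      _            ≈⟨ solve 2 (λ u v → M2.a (P.E₁₂ u P.· P.E₂₁ (:- v) P.· P.E₁₂ u) := con (+ 1) :- u :* v) refl u v ⟩
      1# - u * v   ≈⟨ +-congˡ (-‿cong uv≈1) ⟩
      1# - 1#      ≈⟨ -‿inverseʳ 1# ⟩
      0#           ∎) ,
    (begin
      _                   ≈⟨ solve 2 (λ u v → M2.b (P.E₁₂ u P.· P.E₂₁ (:- v) P.· P.E₁₂ u) := u :* (con (+ 1) :+ con (+ 1) :- u :* v)) refl u v ⟩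
      u * (1# + 1# - u * v) ≈⟨ *-congˡ (+-congˡ (-‿cong uv≈1)) ⟩
      u * (1# + 1# - 1#)    ≈⟨ solve 1 (λ u → u :* (con (+ 1) :+ con (+ 1) :- con (+ 1)) := u) refl u ⟩
      u                   ∎) ,
    solve 2 (λ u v → M2.c' (P.E₁₂ u P.· P.E₂₁ (:- v) P.· P.E₁₂ u) := :- v) refl u v ,
    (begin
      _            ≈⟨ solve 2 (λ u v → M2.d (P.E₁₂ u P.· P.E₂₁ (:- v) P.· P.E₁₂ u) := con (+ 1) :- u :* v) refl u v ⟩
      1# - u * v   ≈⟨ +-congˡ (-‿cong uv≈1) ⟩
      1# - 1#      ≈⟨ -‿inverseʳ 1# ⟩
      0#           ∎)
    where open ≈-Reasoning setoid

  diag-elementary : ∀ {u v} → u * v ≈ 1# → ∃[ g ] (Elementary g × g ≋ diag u v)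
  diag-elementary {u} {v} uv≈1 =
    _ , (upper u ∙ lower (- v) ∙ upper u) ∙ (upper (- 1#) ∙ lower (- - 1#) ∙ upper (- 1#)) ,
    ≋-trans (·-cong (E₁₂E₂₁E₁₂≋antidiag uv≈1) (E₁₂E₂₁E₁₂≋antidiag -1*-1≈1)) antidiag-product
    where
    -1*-1≈1 : - 1# * - 1# ≈ 1#
    -1*-1≈1 = solve 0 (:- con (+ 1) :* :- con (+ 1) := con (+ 1)) refl
    antidiag-product : antidiag u (- v) · antidiag (- 1#) (- - 1#) ≋ diag u v
    antidiag-product =
      solve 2 (λ u v → M2.a (P.antidiag u (:- v) P.· P.antidiag (:- con (+ 1)) (:- :- con (+ 1))) := u) refl u v ,
      solve 2 (λ u v → M2.b (P.antidiag u (:- v) P.· P.antidiag (:- con (+ 1)) (:- :- con (+ 1))) := con (+ 0)) refl u v ,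
      solve 2 (λ u v → M2.c' (P.antidiag u (:- v) P.· P.antidiag (:- con (+ 1)) (:- :- con (+ 1))) := con (+ 0)) refl u v ,
      solve 2 (λ u v → M2.d (P.antidiag u (:- v) P.· P.antidiag (:- con (+ 1)) (:- :- con (+ 1))) := v) refl u v

  lower-diag-upper : ∀ {a b c d v} → a * v ≈ 1# → det (mat a b c d) ≈ 1# → E₂₁ (c * v) · diag a v · E₁₂ (v * b) ≋ mat a b c d
  lower-diag-upper {a} {b} {c} {d} {v} av≈1 det≈1 =
    solve 5 (λ a b c d v → M2.a (P.E₂₁ (c :* v) P.· P.diag a v P.· P.E₁₂ (v :* b)) := a) refl a b c d v ,
    (begin
      _             ≈⟨ solve 5 (λ a b c d v → M2.b (P.E₂₁ (c :* v) P.· P.diag a v P.· P.E₁₂ (v :* b)) := (a :* v) :* b) refl a b c d v ⟩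
      (a * v) * b   ≈⟨ *-congʳ av≈1 ⟩
      1# * b        ≈⟨ *-identityˡ b ⟩
      b             ∎) ,
    (begin
      _             ≈⟨ solve 5 (λ a b c d v → M2.c' (P.E₂₁ (c :* v) P.· P.diag a v P.· P.E₁₂ (v :* b)) := (a :* v) :* c) refl a b c d v ⟩
      (a * v) * c   ≈⟨ *-congʳ av≈1 ⟩
      1# * c        ≈⟨ *-identityˡ c ⟩
      c             ∎) ,
    (begin
      _                                      ≈⟨ solve 5 (λ a b c d v → M2.d (P.E₂₁ (c :* v) P.· P.diag a v P.· P.E₁₂ (v :* b))
                                                                     := (a :* v) :* (c :* v :* b) :+ v) refl a b c d v ⟩
      (a * v) * (c * v * b) + v              ≈⟨ +-congʳ (*-congʳ av≈1) ⟩
      1# * (c * v * b) + v                   ≈⟨ solve 3 (λ c v b → con (+ 1) :* (c :* v :* b) :+ v := v :* (c :* b :+ con (+ 1))) refl c v b ⟩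
      v * (c * b + 1#)                       ≈⟨ *-congˡ (+-congˡ (sym det≈1)) ⟩
      v * (c * b + (a * d + - (b * c)))      ≈⟨ solve 5 (λ a b c d v → v :* (c :* b :+ (a :* d :+ :- (b :* c))) := (a :* v) :* d) refl a b c d v ⟩
      (a * v) * d                            ≈⟨ *-congʳ av≈1 ⟩
      1# * d                                 ≈⟨ *-identityˡ d ⟩
      d                                      ∎)
    where open ≈-Reasoning setoid

  SL₂-elementary : ∀ M {t v} → det M ≈ 1# → (M2.a M + t * M2.c' M) * v ≈ 1# → ∃[ g ] (Elementary g × g ≋ M)
  SL₂-elementary M {t} {v} det≈1 [a+tc]v≈1 =
    let D , D-elementary , D≋diag = diag-elementary a′v≈1 in
    _ , upper (- t) ∙ (lower _ ∙ D-elementary ∙ upper _) ,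
    ≋-trans (·-congˡ (≋-trans (·-congʳ (·-congˡ D≋diag)) (lower-diag-upper a′v≈1 det-M′≈1))) E₁₂[-t]·M′≋M
    where
    M′ = E₁₂ t · M
    a′v≈1 : M2.a M′ * v ≈ 1#
    a′v≈1 = trans (*-congʳ (solve 3 (λ a c t → con (+ 1) :* a :+ t :* c := a :+ t :* c) refl (M2.a M) (M2.c' M) t)) [a+tc]v≈1
    det-M′≈1 : det M′ ≈ 1#
    det-M′≈1 = trans (det-· (E₁₂ t) M) (trans (*-cong (det-E₁₂ t) det≈1) (*-identityˡ 1#))
    E₁₂[-t]·M′≋M : E₁₂ (- t) · M′ ≋ M
    E₁₂[-t]·M′≋M = ≋-trans (≋-sym (·-assoc _ _ _)) (≋-trans (·-congʳ (≋-trans (E₁₂-+ (- t) t) (E₁₂-cong (-‿inverseˡ t)))) (·-identityˡ M))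

module NormalClosureProperties
  {c ℓ} (p k : ℕ) (R : CommutativeRing c ℓ) (H : M2 ℤ → Set) (1-unit : IsUnitModP p (+ 1)) where
  open import Level using (_⊔_)
  import Data.Nat as ℕ
  open import Data.Integer as ℤ using ()
  import Data.Integer.Properties as ℤ
  open import Data.Product using (_,_)
  open import Relation.Binary.PropositionalEquality as ≡ using (_≡_)
  open import Defs hiding (det)

  open CommutativeRing R
  open IntegerCast R using (ι; ι-1)
  open Matrix R

  N : Mx → Set (c ⊔ ℓ)
  N = NormalClosure p k rawRing H

  Ĝ : Mx → Set (c ⊔ ℓ)
  Ĝ = InGhat p k rawRing

  SL₂⊆Ĝ : ∀ g → det g ≈ 1# → Ĝ g
  SL₂⊆Ĝ g det≈1 = (adj g , adj-inverse g det≈1) , + 1 , 1-unit ,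
    trans det≈1 (trans (sym ι-1) (≡.subst (λ z → ι (+ 1) ≈ ι z) (≡.sym (ℤ.^-zeroˡ (k ℕ.∸ 1))) refl))

  SL₂·Ĝ⊆Ĝ : ∀ {g g₀} → det g ≈ 1# → Ĝ g₀ → Ĝ (g · g₀)
  SL₂·Ĝ⊆Ĝ {g} {g₀} det≈1 ((g₀′ , g₀-inv) , u , u-unit , det-g₀) =
    (g₀′ · adj g , inverse-· (adj-inverse g det≈1) g₀-inv) , u , u-unit ,
    trans (det-· g g₀) (trans (*-congʳ det≈1) (trans (*-identityˡ _) det-g₀))

  N-conj : ∀ {g x} → det g ≈ 1# → N x → N (g · x · adj g)
  N-conj {g} det≈1 (conj g₁ g₁′ h g₁∈Ĝ g₁-inv h∈H) =
    resp _ _ (conj (g · g₁) (g₁′ · adj g) h (SL₂·Ĝ⊆Ĝ det≈1 g₁∈Ĝ) (inverse-· (adj-inverse g det≈1) g₁-inv) h∈H)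
      (·-Solver.solve 5 (λ g g₁ e g₁′ g′ → g ⊙ g₁ ⊙ e ⊙ (g₁′ ⊙ g′) ⊜ g ⊙ (g₁ ⊙ e ⊙ g₁′) ⊙ g′) ≋-refl
        g g₁ (embed p k rawRing h) g₁′ (adj g))
  N-conj det≈1 one                = resp _ _ one (≋-sym (conj-I det≈1))
  N-conj det≈1 (mul x y x∈N y∈N)  = resp _ _ (mul _ _ (N-conj det≈1 x∈N) (N-conj det≈1 y∈N)) (conj-· det≈1 x y)
  N-conj det≈1 (inv x y x∈N x-inv) = inv _ _ (N-conj det≈1 x∈N) (conj-inverse det≈1 x-inv)
  N-conj det≈1 (resp x y x∈N x≋y) = resp _ _ (N-conj det≈1 x∈N) (·-congʳ (·-congˡ x≋y))

  embed∈N : ∀ {h} → H h → N (embed p k rawRing h)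
  embed∈N h∈H = resp _ _ (conj I I _ (SL₂⊆Ĝ I det-I) (·-identityˡ I , ·-identityˡ I) h∈H)
    (≋-trans (·-identityʳ _) (·-identityˡ _))

module ElementaryGeneration
  {r ℓ} (p k : ℕ) (R : CommutativeRing r ℓ) (H : M2 ℤ → Set) (1-unit : IsUnitModP p (+ 1)) where
  open import Data.Product using (_,_; proj₁)
  open import Defs using (InverseOf; NormalClosure)

  open CommutativeRing R
  open import Algebra.Properties.Ring ring using (-‿involutive)
  open IntegerCast R using (solve; _:=_; _:+_; _:*_; :-_; _:-_; con)
  open Matrix R
  open ElementaryMatrices R
  open NormalClosureProperties p k R H 1-unit
  import Relation.Binary.Reasoning.Setoid as ≈-Reasoning

  open NormalClosure

  commutator-congˡ : ∀ {g g′ x} → g ≋ g′ → [ g , x ] ≋ [ g′ , x ]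
  commutator-congˡ g≋g′ = ·-congʳ (·-cong (·-congʳ g≋g′) (adj-cong g≋g′))

  commutator-· : ∀ {g g′ x} → det g ≈ 1# → det x ≈ 1# → (g · [ g′ , x ] · adj g) · [ g , x ] ≋ [ g · g′ , x ]
  commutator-· {g} {g′} {x} det-g≈1 det-x≈1 = begin
    (g · (g′ · x · adj g′ · adj x) · adj g) · (g · x · adj g · adj x)
      ≈⟨ ·-Solver.solve 6 (λ g g′ x G′ X′ G → g ⊙ (g′ ⊙ x ⊙ G′ ⊙ X′) ⊙ G ⊙ (g ⊙ x ⊙ G ⊙ X′)
                                            ⊜ g ⊙ g′ ⊙ x ⊙ G′ ⊙ X′ ⊙ G ⊙ g ⊙ (x ⊙ G ⊙ X′))
           ≋-refl g g′ x (adj g′) (adj x) (adj g) ⟩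
    g · g′ · x · adj g′ · adj x · adj g · g · (x · adj g · adj x)
      ≈⟨ cancel-inner (adj-inverseˡ g det-g≈1) _ _ ⟩
    g · g′ · x · adj g′ · adj x · (x · adj g · adj x)
      ≈⟨ ·-Solver.solve 6 (λ g g′ x G′ X′ G → g ⊙ g′ ⊙ x ⊙ G′ ⊙ X′ ⊙ (x ⊙ G ⊙ X′) ⊜ g ⊙ g′ ⊙ x ⊙ G′ ⊙ X′ ⊙ x ⊙ (G ⊙ X′))
           ≋-refl g g′ x (adj g′) (adj x) (adj g) ⟩
    g · g′ · x · adj g′ · adj x · x · (adj g · adj x)
      ≈⟨ cancel-inner (adj-inverseˡ x det-x≈1) _ _ ⟩
    g · g′ · x · adj g′ · (adj g · adj x)
      ≈⟨ ·-Solver.solve 6 (λ g g′ x G′ X′ G → g ⊙ g′ ⊙ x ⊙ G′ ⊙ (G ⊙ X′) ⊜ g ⊙ g′ ⊙ x ⊙ (G′ ⊙ G) ⊙ X′)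
           ≋-refl g g′ x (adj g′) (adj x) (adj g) ⟩
    g · g′ · x · (adj g′ · adj g) · adj x
      ≈⟨ ·-congʳ (·-congˡ (≋-sym (adj-· g g′))) ⟩
    g · g′ · x · adj (g · g′) · adj x ∎
    where open ≋-Reasoning

  -- As E₂₁ y = h₀ · E₁₂ (κ′ y) · h₀⁻¹, each [E₂₁ y , E₁₂ u] is a product of conjugates
  -- of h₀ and h₀⁻¹.
  module _ {h₀ h₀′} (h₀∈N : N h₀) (h₀-inv : InverseOf rawRing h₀′ h₀) (a≈0 : M2.a h₀ ≈ 0#) where
    private
      b = M2.b h₀
      c = M2.c' h₀
      d = M2.d h₀
      δ = det h₀′

      -bc≈det : - (b * c) ≈ det h₀
      -bc≈det = begin
        - (b * c)                       ≈⟨ solve 3 (λ b c d → :- (b :* c) := con (+ 0) :* d :+ :- (b :* c)) refl b c d ⟩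
        0# * d + - (b * c)              ≈⟨ +-congʳ (*-congʳ (sym a≈0)) ⟩
        det h₀                          ∎
        where open ≈-Reasoning setoid

      -bcδ≈1 : - (b * c) * δ ≈ 1#
      -bcδ≈1 = trans (*-congʳ -bc≈det) (det-inverse (proj₁ h₀-inv))

      -- κ = c b⁻¹ and κ′ = b c⁻¹: as a ≈ 0, det h₀ = - b c, so b⁻¹ = - c δ and c⁻¹ = - b δ
      κ κ′ : Carrier
      κ  = c * - (c * δ)
      κ′ = b * - (b * δ)

      κb≈c : κ * b ≈ c
      κb≈c = begin
        c * - (c * δ) * b     ≈⟨ solve 3 (λ b c δ → c :* :- (c :* δ) :* b := c :* (:- (b :* c) :* δ)) refl b c δ ⟩
        c * (- (b * c) * δ)   ≈⟨ *-congˡ -bcδ≈1 ⟩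
        c * 1#                ≈⟨ *-identityʳ c ⟩
        c                     ∎
        where open ≈-Reasoning setoid

      κκ′≈1 : κ * κ′ ≈ 1#
      κκ′≈1 = begin
        c * - (c * δ) * (b * - (b * δ))        ≈⟨ solve 3 (λ b c δ → c :* :- (c :* δ) :* (b :* :- (b :* δ)) := :- (b :* c) :* δ :* (:- (b :* c) :* δ)) refl b c δ ⟩
        - (b * c) * δ * (- (b * c) * δ)        ≈⟨ *-cong -bcδ≈1 -bcδ≈1 ⟩
        1# * 1#                                ≈⟨ *-identityˡ 1# ⟩
        1#                                     ∎
        where open ≈-Reasoning setoid

      h₀E₁₂≋E₂₁h₀ : ∀ x → h₀ · E₁₂ x ≋ E₂₁ (κ * x) · h₀
      h₀E₁₂≋E₂₁h₀ x =
        solve 5 (λ a b c d x → a :* con (+ 1) :+ b :* con (+ 0) := con (+ 1) :* a :+ con (+ 0) :* c) refl (M2.a h₀) b c d x ,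
        trans (+-congʳ (*-congʳ a≈0)) (solve 3 (λ b d x → con (+ 0) :* x :+ b :* con (+ 1) := con (+ 1) :* b :+ con (+ 0) :* d) refl b d x) ,
        trans (solve 4 (λ c d x κ → c :* con (+ 1) :+ d :* con (+ 0) := (κ :* x) :* con (+ 0) :+ con (+ 1) :* c) refl c d x κ)
              (+-congʳ (*-congˡ (sym a≈0))) ,
        trans (+-congʳ (*-congʳ (sym κb≈c))) (solve 4 (λ b d x κ → κ :* b :* x :+ d :* con (+ 1) := (κ :* x) :* b :+ con (+ 1) :* d) refl b d x κ)

      E₂₁≋h₀E₁₂h₀⁻¹ : ∀ y → E₂₁ y ≋ h₀ · E₁₂ (κ′ * y) · h₀′
      E₂₁≋h₀E₁₂h₀⁻¹ y = begin
        E₂₁ y                       ≈⟨ E₂₁-cong (sym (trans (sym (*-assoc κ κ′ y)) (trans (*-congʳ κκ′≈1) (*-identityˡ y)))) ⟩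
        E₂₁ (κ * (κ′ * y))          ≈⟨ ≋-sym (·-identityʳ _) ⟩
        E₂₁ (κ * (κ′ * y)) · I      ≈⟨ ·-congˡ (≋-sym (proj₁ h₀-inv)) ⟩
        E₂₁ (κ * (κ′ * y)) · (h₀ · h₀′) ≈⟨ ≋-sym (·-assoc _ _ _) ⟩
        E₂₁ (κ * (κ′ * y)) · h₀ · h₀′ ≈⟨ ·-congʳ (≋-sym (h₀E₁₂≋E₂₁h₀ (κ′ * y))) ⟩
        h₀ · E₁₂ (κ′ * y) · h₀′     ∎
        where open ≋-Reasoning

    [E₂₁,E₁₂]∈N : ∀ y u → N [ E₂₁ y , E₁₂ u ]
    [E₂₁,E₁₂]∈N y u = resp _ _ product∈N product≋commutator
      where
      X = E₁₂ (κ′ * y)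
      U = E₁₂ u
      h₀′∈N : N h₀′
      h₀′∈N = inv _ _ h₀∈N h₀-inv
      product∈N : N (h₀ · (X · (h₀′ · (U · h₀ · adj U)) · adj X) · (U · h₀′ · adj U))
      product∈N = mul _ _ (mul _ _ h₀∈N (N-conj (det-E₁₂ _) (mul _ _ h₀′∈N (N-conj (det-E₁₂ u) h₀∈N))))
                          (N-conj (det-E₁₂ u) h₀′∈N)
      product≋commutator : h₀ · (X · (h₀′ · (U · h₀ · adj U)) · adj X) · (U · h₀′ · adj U) ≋ [ E₂₁ y , E₁₂ u ]
      product≋commutator = begin
        h₀ · (X · (h₀′ · (U · h₀ · adj U)) · adj X) · (U · h₀′ · adj U)
          ≈⟨ ·-Solver.solve 6 (λ h h′ X U U′ X′ → h ⊙ (X ⊙ (h′ ⊙ (U ⊙ h ⊙ U′)) ⊙ X′) ⊙ (U ⊙ h′ ⊙ U′)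
                                                ⊜ h ⊙ X ⊙ h′ ⊙ U ⊙ (h ⊙ (U′ ⊙ X′ ⊙ U) ⊙ h′) ⊙ U′)
               ≋-refl h₀ h₀′ X U (adj U) (adj X) ⟩
        h₀ · X · h₀′ · U · (h₀ · (adj U · adj X · U) · h₀′) · adj U
          ≈⟨ ·-congʳ (·-congˡ (·-congʳ (·-congˡ U⁻¹X⁻¹U≋E₁₂))) ⟩
        h₀ · X · h₀′ · U · (h₀ · E₁₂ (κ′ * - y) · h₀′) · adj U
          ≈⟨ ·-congʳ (·-cong (·-congʳ (≋-sym (E₂₁≋h₀E₁₂h₀⁻¹ y)))
                             (≋-trans (≋-sym (E₂₁≋h₀E₁₂h₀⁻¹ (- y))) (≋-sym (adj-E₂₁ y)))) ⟩
        E₂₁ y · E₁₂ u · adj (E₂₁ y) · adj (E₁₂ u) ∎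
        where
        open ≋-Reasoning
        U⁻¹X⁻¹U≋E₁₂ : adj U · adj X · U ≋ E₁₂ (κ′ * - y)
        U⁻¹X⁻¹U≋E₁₂ = ≋-trans (·-congʳ (·-cong (adj-E₁₂ u) (adj-E₁₂ _))) (≋-trans (·-congʳ (E₁₂-+ _ _))
          (≋-trans (E₁₂-+ _ _) (E₁₂-cong (solve 3 (λ u κ′ y → :- u :+ :- (κ′ :* y) :+ u := κ′ :* :- y) refl u κ′ y))))

  [E₁₂,E₁₂]≋I : ∀ s t → [ E₁₂ s , E₁₂ t ] ≋ I
  [E₁₂,E₁₂]≋I s t =
    ≋-trans (·-cong (·-cong ≋-refl (adj-E₁₂ s)) (adj-E₁₂ t))
    (≋-trans (·-congʳ (·-congʳ (E₁₂-+ s t)))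
    (≋-trans (·-congʳ (E₁₂-+ _ _))
    (≋-trans (E₁₂-+ _ _)
    (E₁₂-cong (solve 2 (λ s t → s :+ t :+ :- s :+ :- t := con (+ 0)) refl s t)))))

  [diag,E₁₂]≋E₁₂ : ∀ {u v} t → u * v ≈ 1# → [ diag u v , E₁₂ t ] ≋ E₁₂ ((u * u - 1#) * t)
  [diag,E₁₂]≋E₁₂ {u} {v} t uv≈1 =
    (begin
      _       ≈⟨ solve 3 (λ u v t → M2.a P.[ P.diag u v , P.E₁₂ t ] := u :* v) refl u v t ⟩
      u * v   ≈⟨ uv≈1 ⟩
      1#      ∎) ,
    (begin
      _                             ≈⟨ solve 3 (λ u v t → M2.b P.[ P.diag u v , P.E₁₂ t ] := (u :* v) :* (:- t) :+ u :* u :* t) refl u v t ⟩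
      (u * v) * (- t) + u * u * t   ≈⟨ +-congʳ (*-congʳ uv≈1) ⟩
      1# * (- t) + u * u * t        ≈⟨ solve 2 (λ u t → con (+ 1) :* (:- t) :+ u :* u :* t := (u :* u :- con (+ 1)) :* t) refl u t ⟩
      (u * u - 1#) * t              ∎) ,
    solve 3 (λ u v t → M2.c' P.[ P.diag u v , P.E₁₂ t ] := con (+ 0)) refl u v t ,
    (begin
      _       ≈⟨ solve 3 (λ u v t → M2.d P.[ P.diag u v , P.E₁₂ t ] := u :* v) refl u v t ⟩
      u * v   ≈⟨ uv≈1 ⟩
      1#      ∎)
    where
    open ≈-Reasoning setoid

  w-conj-E₁₂ : ∀ x → w · E₁₂ x · adj w ≋ E₂₁ (- x)
  w-conj-E₁₂ x =
    solve 1 (λ x → M2.a (P.w P.· P.E₁₂ x P.· P.adj P.w) := con (+ 1)) refl x ,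
    solve 1 (λ x → M2.b (P.w P.· P.E₁₂ x P.· P.adj P.w) := con (+ 0)) refl x ,
    solve 1 (λ x → M2.c' (P.w P.· P.E₁₂ x P.· P.adj P.w) := :- x) refl x ,
    solve 1 (λ x → M2.d (P.w P.· P.E₁₂ x P.· P.adj P.w) := con (+ 1)) refl x

  module _ ([E₂₁,E₁₂]∈N : ∀ y u → N [ E₂₁ y , E₁₂ u ]) where

    [elementary,E₁₂]∈N : ∀ {g} → Elementary g → ∀ t → N [ g , E₁₂ t ]
    [elementary,E₁₂]∈N (upper s) t = resp _ _ one (≋-sym ([E₁₂,E₁₂]≋I s t))
    [elementary,E₁₂]∈N (lower y) t = [E₂₁,E₁₂]∈N y t
    [elementary,E₁₂]∈N (e ∙ e′)  t = resp _ _
      (mul _ _ (N-conj (elementary-det e) ([elementary,E₁₂]∈N e′ t)) ([elementary,E₁₂]∈N e t))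
      (commutator-· (elementary-det e) (det-E₁₂ t))

    module _ {½ ⅓} (2½≈1 : (1# + 1#) * ½ ≈ 1#) (3⅓≈1 : (1# + 1# + 1#) * ⅓ ≈ 1#) where

      -- conjugation by diag 2 ½ scales the upper entry by 4, leaving a commutator E₁₂ (3 t)
      E₁₂∈N : ∀ t → N (E₁₂ t)
      E₁₂∈N t =
        let D , D-elementary , D≋diag = diag-elementary 2½≈1 in
        resp _ _ ([elementary,E₁₂]∈N D-elementary (⅓ * t))
          (≋-trans (commutator-congˡ D≋diag) (≋-trans ([diag,E₁₂]≋E₁₂ (⅓ * t) 2½≈1) (E₁₂-cong 3⅓t≈t)))
        where
        3⅓t≈t : ((1# + 1#) * (1# + 1#) - 1#) * (⅓ * t) ≈ t
        3⅓t≈t = begin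
          ((1# + 1#) * (1# + 1#) - 1#) * (⅓ * t)  ≈⟨ solve 2 (λ ⅓ t → ((con (+ 1) :+ con (+ 1)) :* (con (+ 1) :+ con (+ 1)) :- con (+ 1)) :* (⅓ :* t)
                                                               := ((con (+ 1) :+ con (+ 1) :+ con (+ 1)) :* ⅓) :* t) refl ⅓ t ⟩
          ((1# + 1# + 1#) * ⅓) * t                ≈⟨ *-congʳ 3⅓≈1 ⟩
          1# * t                                  ≈⟨ *-identityˡ t ⟩
          t                                       ∎
          where open ≈-Reasoning setoid

      E₂₁∈N : ∀ t → N (E₂₁ t)
      E₂₁∈N t = resp _ _ (N-conj det-w (E₁₂∈N (- t))) (≋-trans (w-conj-E₁₂ (- t)) (E₂₁-cong (-‿involutive t)))

      elementary∈N : ∀ {g} → Elementary g → N g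
      elementary∈N (upper x) = E₁₂∈N x
      elementary∈N (lower x) = E₂₁∈N x
      elementary∈N (e ∙ e′)  = mul _ _ (elementary∈N e) (elementary∈N e′)

      SL₂⊆N : ∀ M {t v} → det M ≈ 1# → (M2.a M + t * M2.c' M) * v ≈ 1# → N M
      SL₂⊆N M det≈1 [a+tc]v≈1 =
        let g , g-elementary , g≋M = SL₂-elementary M det≈1 [a+tc]v≈1 in
        resp _ _ (elementary∈N g-elementary) g≋M

module LocalRing {r ℓ} (R : CommutativeRing r ℓ) (local : IsLocal R) where
  open import Data.Integer using (+_)
  open import Data.Product using (∃-syntax; _,_; proj₂)
  open import Data.Sum using (inj₁; inj₂)
  open import Defs using (M2; mat)

  open CommutativeRing R
  open Matrix R using (det)
  open IntegerCast R using (solve; _:=_; _:+_; _:*_; :-_; _:-_; con)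
  open import Relation.Binary.Reasoning.Setoid setoid

  -- Either a x or 1 - a x = c y is a unit; in the second case c is a unit and
  -- t = (1 - a) c⁻¹ works.
  unimodular⇒shift-unit : ∀ {a c x y} → a * x + c * y ≈ 1# → ∃[ t ] ∃[ v ] ((a + t * c) * v ≈ 1#)
  unimodular⇒shift-unit {a} {c} {x} {y} ax+cy≈1 with proj₂ local (a * x)
  ... | inj₁ (z , axz≈1) = 0# , x * z , (begin
    (a + 0# * c) * (x * z)  ≈⟨ solve 4 (λ a c x z → (a :+ con (+ 0) :* c) :* (x :* z) := a :* x :* z) refl a c x z ⟩
    a * x * z               ≈⟨ axz≈1 ⟩
    1#                      ∎)
  ... | inj₂ (z , [1-ax]z≈1) = (1# - a) * (y * z) , 1# , (begin
    (a + (1# - a) * (y * z) * c) * 1#  ≈⟨ solve 4 (λ a c y z → (a :+ (con (+ 1) :- a) :* (y :* z) :* c) :* con (+ 1)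
                                                               := a :+ (con (+ 1) :- a) :* ((c :* y) :* z)) refl a c y z ⟩
    a + (1# - a) * ((c * y) * z)       ≈⟨ +-congˡ (*-congˡ (trans (*-congʳ cy≈1-ax) [1-ax]z≈1)) ⟩
    a + (1# - a) * 1#                  ≈⟨ solve 1 (λ a → a :+ (con (+ 1) :- a) :* con (+ 1) := con (+ 1)) refl a ⟩
    1#                                 ∎)
    where
    cy≈1-ax : c * y ≈ 1# - a * x
    cy≈1-ax = begin
      c * y                    ≈⟨ solve 2 (λ ax cy → cy := (ax :+ cy) :- ax) refl (a * x) (c * y) ⟩
      (a * x + c * y) - a * x  ≈⟨ +-congʳ ax+cy≈1 ⟩
      1# - a * x               ∎

  det≈1⇒shift-unit : ∀ M → det M ≈ 1# → ∃[ t ] ∃[ v ] ((M2.a M + t * M2.c' M) * v ≈ 1#)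
  det≈1⇒shift-unit (mat a b c d) det≈1 =
    unimodular⇒shift-unit (trans (+-congˡ (solve 3 (λ b c d → c :* :- b := :- (b :* c)) refl b c d)) det≈1)

module IndexedProduct {r ℓ} {I : Set} (A : I → CommutativeRing r ℓ) where
  open import Data.Product using (_,_)
  open import Relation.Binary.PropositionalEquality using (_≡_; refl; cong)
  open import Data.Nat using (zero; suc)
  open import Defs using (natCast)

  private
    module A i = CommutativeRing (A i)

  Π-commutativeRing : CommutativeRing r ℓ
  Π-commutativeRing = record
    { Carrier = ∀ i → A.Carrier i
    ; _≈_ = λ x y → ∀ i → A._≈_ i (x i) (y i)
    ; _+_ = λ x y i → A._+_ i (x i) (y i)
    ; _*_ = λ x y i → A._*_ i (x i) (y i)
    ; -_  = λ x i → A.-_ i (x i)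
    ; 0#  = λ i → A.0# i
    ; 1#  = λ i → A.1# i
    ; isCommutativeRing = record
      { isRing = record
        { +-isAbelianGroup = record
          { isGroup = record
            { isMonoid = record
              { isSemigroup = record
                { isMagma = record
                  { isEquivalence = record
                    { refl  = λ i → A.refl i
                    ; sym   = λ x≈y i → A.sym i (x≈y i)
                    ; trans = λ x≈y y≈z i → A.trans i (x≈y i) (y≈z i) }
                  ; ∙-cong = λ x≈y u≈v i → A.+-cong i (x≈y i) (u≈v i) }
                ; assoc = λ x y z i → A.+-assoc i (x i) (y i) (z i) }
              ; identity = (λ x i → A.+-identityˡ i (x i)) , (λ x i → A.+-identityʳ i (x i)) }
            ; inverse = (λ x i → A.-‿inverseˡ i (x i)) , (λ x i → A.-‿inverseʳ i (x i))
            ; ⁻¹-cong = λ x≈y i → A.-‿cong i (x≈y i) }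
          ; comm = λ x y i → A.+-comm i (x i) (y i) }
        ; *-cong = λ x≈y u≈v i → A.*-cong i (x≈y i) (u≈v i)
        ; *-assoc = λ x y z i → A.*-assoc i (x i) (y i) (z i)
        ; *-identity = (λ x i → A.*-identityˡ i (x i)) , (λ x i → A.*-identityʳ i (x i))
        ; distrib = (λ x y z i → A.distribˡ i (x i) (y i) (z i)) , (λ x y z i → A.distribʳ i (x i) (y i) (z i)) }
      ; *-comm = λ x y i → A.*-comm i (x i) (y i) }
    }

  natCast-Π : ∀ n i → natCast (CommutativeRing.rawRing Π-commutativeRing) n i ≡ natCast (CommutativeRing.rawRing (A i)) n
  natCast-Π zero    i = refl
  natCast-Π (suc n) i = cong (A._+_ i (A.1# i)) (natCast-Π n i)

module ProductOfLocalRings {r ℓ} {I : Set} (A : I → CommutativeRing r ℓ) (local : ∀ i → IsLocal (A i)) where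
  open import Data.Product using (_,_; proj₁; proj₂)
  open import Defs using (M2; mapM2)
  open IndexedProduct A
  open CommutativeRing Π-commutativeRing
  open Matrix Π-commutativeRing using (det)

  det≈1⇒shift-unit : ∀ M → det M ≈ 1# → ∃[ t ] ∃[ v ] ((M2.a M + t * M2.c' M) * v ≈ 1#)
  det≈1⇒shift-unit M det≈1 = (λ i → proj₁ (shift i)) , (λ i → proj₁ (proj₂ (shift i))) , (λ i → proj₂ (proj₂ (shift i)))
    where shift = λ i → LocalRing.det≈1⇒shift-unit (A i) (local i) (mapM2 (λ x → x i) M) (det≈1 i)

module PrimeBinomialCoefficients where
  open import Data.Nat using (zero; suc; _+_; _*_; _<_)
  open import Data.Nat.Properties using (*-zeroʳ; *-identityˡ; *-identityʳ; *-comm; <⇒≱)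
  open import Data.Nat.Divisibility using (_∣_; divides; ∣⇒≤)
  open import Data.Nat.Primality using (Prime; euclidsLemma)
  open import Data.Nat.Combinatorics using (_C_; nCk+nC[k+1]≡[n+1]C[k+1]; nC1≡n)
  open import Data.Nat.Tactic.RingSolver using (solve-∀)
  open import Data.Sum using (inj₁; inj₂)
  open import Data.Empty using (⊥-elim)
  open import Relation.Binary.PropositionalEquality using (_≡_; refl; sym; trans; cong; cong₂; module ≡-Reasoning)

  [1+k]*[1+n]C[1+k]≡[1+n]*nCk : ∀ n k → suc k * (suc n C suc k) ≡ suc n * (n C k)
  [1+k]*[1+n]C[1+k]≡[1+n]*nCk zero    zero    = refl
  [1+k]*[1+n]C[1+k]≡[1+n]*nCk zero    (suc k) = *-zeroʳ (suc (suc k))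
  [1+k]*[1+n]C[1+k]≡[1+n]*nCk (suc n) zero    = trans (*-identityˡ _) (trans (nC1≡n (suc (suc n))) (sym (*-identityʳ _)))
  [1+k]*[1+n]C[1+k]≡[1+n]*nCk (suc n) (suc k) = begin
    suc (suc k) * (suc (suc n) C suc (suc k)) ≡⟨ cong (suc (suc k) *_) (sym (nCk+nC[k+1]≡[n+1]C[k+1] (suc n) (suc k))) ⟩
    suc (suc k) * (X + Y)                     ≡⟨ expand k X Y ⟩
    X + suc k * X + suc (suc k) * Y           ≡⟨ cong₂ (λ u v → X + u + v) ([1+k]*[1+n]C[1+k]≡[1+n]*nCk n k) ([1+k]*[1+n]C[1+k]≡[1+n]*nCk n (suc k)) ⟩
    X + suc n * (n C k) + suc n * (n C suc k) ≡⟨ factor X (suc n) (n C k) (n C suc k) ⟩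
    X + suc n * (n C k + n C suc k)           ≡⟨ cong (λ u → X + suc n * u) (nCk+nC[k+1]≡[n+1]C[k+1] n k) ⟩
    suc (suc n) * X                           ∎
    where
    open ≡-Reasoning
    X = suc n C suc k
    Y = suc n C suc (suc k)
    expand : ∀ k X Y → suc (suc k) * (X + Y) ≡ X + suc k * X + suc (suc k) * Y
    expand = solve-∀
    factor : ∀ X a b c → X + a * b + a * c ≡ X + a * (b + c)
    factor = solve-∀

  p∣pCk : ∀ {p k} → Prime p → 0 < k → k < p → p ∣ p C k
  p∣pCk {suc n} {suc k} p-prime _ k<p
    with euclidsLemma (suc k) (suc n C suc k) p-prime
           (divides (n C k) (trans ([1+k]*[1+n]C[1+k]≡[1+n]*nCk n k) (*-comm (suc n) (n C k))))
  ... | inj₂ p∣pCk = p∣pCk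
  ... | inj₁ p∣1+k = ⊥-elim (<⇒≱ k<p (∣⇒≤ p∣1+k))

module Frobenius {r ℓ} (R : CommutativeRing r ℓ) where
  open import Data.Nat as ℕ using (ℕ; zero; suc; s≤s; z≤n)
  import Data.Nat.Properties as ℕ
  open import Data.Nat.Divisibility using (_∣_; divides)
  open import Data.Nat.Primality using (Prime; prime⇒nonZero)
  open import Data.Nat.Combinatorics using (nCn≡1)
  open import Data.Fin as Fin using (Fin; inject₁; fromℕ)
  import Data.Fin.Properties as Fin
  open import Data.Empty using (⊥-elim)
  open import Function using (_∘_)
  open import Relation.Binary.PropositionalEquality as ≡ using (_≡_)
  open import Defs using (natCast; Is𝔽Algebra)

  open CommutativeRing R
  open import Algebra.Properties.Semiring.Exp semiring using (_^_)
  open import Algebra.Properties.Semiring.Mult semiring using (_×_; ×-assoc-*)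
  open import Algebra.Properties.Monoid.Mult +-monoid using (×-assocˡ; ×-congʳ)
  open import Algebra.Properties.Monoid.Sum +-monoid using (sum; sum-init-last; sum-cong-≋; sum-replicate-zero)
  open import Algebra.Properties.CommutativeSemiring.Binomial commutativeSemiring using (theorem; binomialTerm)
  open IntegerCast R using (natCast≡×1)
  open PrimeBinomialCoefficients using (p∣pCk)
  open import Relation.Binary.Reasoning.Setoid setoid

  module _ {p} (char-p : Is𝔽Algebra R p) where

    p×≈0 : ∀ x → p × x ≈ 0#
    p×≈0 x = begin
      p × x                  ≈⟨ ×-congʳ p (sym (*-identityˡ x)) ⟩
      p × (1# * x)           ≈⟨ sym (×-assoc-* p 1# x) ⟩
      (p × 1#) * x           ≡⟨ ≡.cong (_* x) (≡.sym (natCast≡×1 p)) ⟩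
      natCast rawRing p * x  ≈⟨ *-congʳ char-p ⟩
      0# * x                 ≈⟨ zeroˡ x ⟩
      0#                     ∎

    ∣×≈0 : ∀ {m} x → p ∣ m → m × x ≈ 0#
    ∣×≈0 {m} x (divides q m≡q*p) = begin
      m × x            ≡⟨ ≡.cong (_× x) (≡.trans m≡q*p (ℕ.*-comm q p)) ⟩
      (p ℕ.* q) × x    ≈⟨ sym (×-assocˡ x p q) ⟩
      p × (q × x)      ≈⟨ p×≈0 (q × x) ⟩
      0#               ∎

  frobenius : ∀ {p} → Prime p → Is𝔽Algebra R p → ∀ x y → (x + y) ^ p ≈ x ^ p + y ^ p
  frobenius {zero}  p-prime = ⊥-elim (ℕ.≢-nonZero⁻¹ 0 {{prime⇒nonZero p-prime}} ≡.refl)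
  frobenius {suc n} p-prime char-p x y = begin
    (x + y) ^ suc n                                    ≈⟨ theorem (suc n) x y ⟩
    t Fin.zero + sum (tail t)                          ≈⟨ +-cong first (sum-init-last (tail t)) ⟩
    y ^ suc n + (sum (init (tail t)) + last (tail t))  ≈⟨ +-congˡ (+-cong (trans (sum-cong-≋ middle) (sum-replicate-zero n)) final) ⟩
    y ^ suc n + (0# + x ^ suc n)                       ≈⟨ trans (+-congˡ (+-identityˡ _)) (+-comm _ _) ⟩
    x ^ suc n + y ^ suc n                              ∎
    where
    t = binomialTerm x y (suc n)
    tail : ∀ {m} → (Fin (suc m) → Carrier) → Fin m → Carrier
    tail v = v ∘ Fin.suc
    init : ∀ {m} → (Fin (suc m) → Carrier) → Fin m → Carrier
    init v = v ∘ inject₁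
    last : ∀ {m} → (Fin (suc m) → Carrier) → Carrier
    last {m} v = v (fromℕ m)
    first : t Fin.zero ≈ y ^ suc n
    first = trans (+-identityʳ _) (*-identityˡ _)
    middle : ∀ j → init (tail t) j ≈ 0#
    middle j = ∣×≈0 char-p _ (p∣pCk p-prime (s≤s z≤n) (s≤s (≡.subst (ℕ._< n) (≡.sym (Fin.toℕ-inject₁ j)) (Fin.toℕ<n j))))
    final : last (tail t) ≈ x ^ suc n
    final rewrite Fin.toℕ-fromℕ n | nCn≡1 (suc n) | ℕ.n∸n≡0 n = trans (+-identityʳ _) (*-identityʳ _)

module _ {r ℓ} (R : CommutativeRing r ℓ) where
  open CommutativeRing R

  record IsIntegralDomain : Set (r ⊔ ℓ) where
    field
      1≉0      : 1# ≉ 0#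
      integral : ∀ {x y} → x * y ≈ 0# → x ≈ 0# ⊎ y ≈ 0#

  record IsDiscreteField : Set (r ⊔ ℓ) where
    field
      ≈0?     : ∀ x → Dec (x ≈ 0#)
      inverse : ∀ {x} → x ≉ 0# → ∃[ y ] (x * y ≈ 1#)

module RootBound {r ℓ} (R : CommutativeRing r ℓ) (domain : IsIntegralDomain R) where
  open import Data.Nat using (_≤_; z≤n; s≤s)
  open import Data.Fin using (Fin; zero; suc)
  open import Data.Fin.Properties using (suc-injective)
  open import Data.Nat as ℕ using ()
  open import Data.Vec using (Vec; []; _∷_)
  open import Data.Integer using (+_)
  open import Data.Sum using (inj₁; inj₂)
  open import Data.Empty using (⊥-elim)
  open import Function using (_∘_)
  open import Relation.Nullary using (contradiction)
  open import Relation.Binary.PropositionalEquality using (_≡_)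
  open CommutativeRing R hiding (zero)
  open IsIntegralDomain domain
  open import Algebra.Properties.Group +-group using (x∙y⁻¹≈ε⇒x≈y)
  open IntegerCast R using (solve; _:=_; _:+_; _:*_; :-_; _:-_; con)
  open import Relation.Binary.Reasoning.Setoid setoid

  monic : ∀ {m} → Vec Carrier m → Carrier → Carrier
  monic []       x = 1#
  monic (c ∷ cs) x = c + x * monic cs x

  quotient : ∀ {m} → Carrier → Vec Carrier (ℕ.suc m) → Vec Carrier m
  quotient a (c ∷ [])     = []
  quotient a (c ∷ d ∷ cs) = monic (d ∷ cs) a ∷ quotient a (d ∷ cs)

  monic-divide : ∀ {m} a (cs : Vec Carrier (ℕ.suc m)) x → monic cs x ≈ monic cs a + (x - a) * monic (quotient a cs) x
  monic-divide a (c ∷ [])     x = solve 3 (λ c a x → c :+ x :* con (+ 1) := (c :+ a :* con (+ 1)) :+ (x :- a) :* con (+ 1)) refl c a x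
  monic-divide a (c ∷ d ∷ cs) x = trans (+-congˡ (*-congˡ (monic-divide a (d ∷ cs) x)))
    (solve 5 (λ c x a E Q → c :+ x :* (E :+ (x :- a) :* Q) := (c :+ a :* E) :+ (x :- a) :* (E :+ x :* Q)) refl
      c x a (monic (d ∷ cs) a) (monic (quotient a (d ∷ cs)) x))

  roots-bound : ∀ {m n} (cs : Vec Carrier m) (root : Fin n → Carrier) →
                (∀ i → monic cs (root i) ≈ 0#) → (∀ i j → root i ≈ root j → i ≡ j) → n ≤ m
  roots-bound {n = ℕ.zero}  cs       root is-root injective = z≤n
  roots-bound {n = ℕ.suc n} []       root is-root injective = ⊥-elim (1≉0 (is-root zero))
  roots-bound {n = ℕ.suc n} (c ∷ cs) root is-root injective =
    s≤s (roots-bound (quotient a (c ∷ cs)) (root ∘ suc) quotient-root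
          (λ i j rᵢ≈rⱼ → suc-injective (injective (suc i) (suc j) rᵢ≈rⱼ)))
    where
    a = root zero
    q = monic (quotient a (c ∷ cs))

    [x-a]q[x]≈0 : ∀ i → (root (suc i) - a) * q (root (suc i)) ≈ 0#
    [x-a]q[x]≈0 i = begin
      (x - a) * q x                                        ≈⟨ solve 2 (λ u v → v := (u :+ v) :- u) refl (monic (c ∷ cs) a) _ ⟩
      (monic (c ∷ cs) a + (x - a) * q x) - monic (c ∷ cs) a ≈⟨ +-cong (sym (monic-divide a (c ∷ cs) x)) (-‿cong (is-root zero)) ⟩
      monic (c ∷ cs) x - 0#                                ≈⟨ +-congʳ (is-root (suc i)) ⟩
      0# - 0#                                              ≈⟨ -‿inverseʳ 0# ⟩
      0#                                                   ∎
      where x = root (suc i)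

    quotient-root : ∀ i → q (root (suc i)) ≈ 0#
    quotient-root i with integral ([x-a]q[x]≈0 i)
    ... | inj₁ x-a≈0 = contradiction (injective (suc i) zero (x∙y⁻¹≈ε⇒x≈y _ _ x-a≈0)) λ ()
    ... | inj₂ q≈0   = q≈0

module FieldConjugation {r ℓ} (F : CommutativeRing r ℓ) (discrete-field : IsDiscreteField F) where
  open import Data.Integer using (+_)
  open import Data.Product using (_×_; _,_; proj₁)
  open import Relation.Nullary using (yes; no)
  open import Relation.Nullary.Decidable using (_×-dec_; map′)
  open import Defs using (M2; mat)

  open CommutativeRing F
  open IsDiscreteField discrete-field
  open import Algebra.Properties.Group +-group using (x∙y⁻¹≈ε⇒x≈y; x≈y⇒x∙y⁻¹≈ε)
  open import Algebra.Properties.Ring ring using (-0#≈0#)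
  open IntegerCast F using (solve; _:=_; _:+_; _:*_; :-_; _:-_; con)
  open Matrix F
  open import Relation.Binary.Reasoning.Setoid setoid

  Scalar : Mx → Set ℓ
  Scalar M = M2.b M ≈ 0# × M2.c' M ≈ 0# × M2.a M ≈ M2.d M

  Scalar? : ∀ M → Dec (Scalar M)
  Scalar? M = ≈0? (M2.b M) ×-dec ≈0? (M2.c' M) ×-dec map′ (x∙y⁻¹≈ε⇒x≈y _ _) x≈y⇒x∙y⁻¹≈ε (≈0? (M2.a M - M2.d M))

  non-scalar⇒conjugate-c≉0 : ∀ M → ¬ Scalar M → ∃[ G ] (det G ≈ 1# × M2.c' (G · M · adj G) ≉ 0#)
  non-scalar⇒conjugate-c≉0 (mat a b c d) non-scalar with ≈0? c | ≈0? b
  ... | no c≉0 | _ = I , det-I , λ c′≈0 → c≉0 (trans c≈c′ c′≈0)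
    where
    c≈c′ : c ≈ M2.c' (I · mat a b c d · adj I)
    c≈c′ = solve 4 (λ a b c d → c := M2.c' (P.I P.· mat a b c d P.· P.adj P.I)) refl a b c d
  ... | yes c≈0 | no b≉0 = w , det-w , λ c′≈0 → b≉0 (trans (sym -c′≈b) (trans (-‿cong c′≈0) -0#≈0#))
    where
    -c′≈b : - M2.c' (w · mat a b c d · adj w) ≈ b
    -c′≈b = solve 4 (λ a b c d → :- M2.c' (P.w P.· mat a b c d P.· P.adj P.w) := b) refl a b c d
  ... | yes c≈0 | yes b≈0 = E₂₁ 1# , det-E₂₁ 1# , λ c′≈0 → non-scalar (b≈0 , c≈0 , x∙y⁻¹≈ε⇒x≈y a d (trans a-d≈c′ c′≈0))
    where
    a-d≈c′ : a - d ≈ M2.c' (E₂₁ 1# · mat a b c d · adj (E₂₁ 1#))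
    a-d≈c′ = begin
      a - d                 ≈⟨ solve 4 (λ a b c d → a :- d := M2.c' (P.E₂₁ (con (+ 1)) P.· mat a b c d P.· P.adj (P.E₂₁ (con (+ 1)))) :+ b :- c) refl a b c d ⟩
      C + b - c             ≈⟨ +-cong (+-congˡ b≈0) (-‿cong c≈0) ⟩
      C + 0# - 0#           ≈⟨ solve 1 (λ C → C :+ con (+ 0) :- con (+ 0) := C) refl C ⟩
      C                     ∎
      where C = M2.c' (E₂₁ 1# · mat a b c d · adj (E₂₁ 1#))

  c≉0⇒conjugate-a≈0 : ∀ M → M2.c' M ≉ 0# → ∃[ G ] (det G ≈ 1# × M2.a (G · M · adj G) ≈ 0#)
  c≉0⇒conjugate-a≈0 (mat a b c d) c≉0 =
    let c⁻¹ , cc⁻¹≈1 = inverse c≉0 in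
    E₁₂ (- (a * c⁻¹)) , det-E₁₂ _ , (begin
      M2.a (E₁₂ (- (a * c⁻¹)) · mat a b c d · adj (E₁₂ (- (a * c⁻¹))))
        ≈⟨ solve 5 (λ a b c d c⁻¹ → M2.a (P.E₁₂ (:- (a :* c⁻¹)) P.· mat a b c d P.· P.adj (P.E₁₂ (:- (a :* c⁻¹))))
                                   := a :- a :* (c :* c⁻¹)) refl a b c d c⁻¹ ⟩
      a - a * (c * c⁻¹)  ≈⟨ +-congˡ (-‿cong (*-congˡ cc⁻¹≈1)) ⟩
      a - a * 1#         ≈⟨ solve 1 (λ a → a :- a :* con (+ 1) := con (+ 0)) refl a ⟩
      0#                 ∎)

  non-scalar⇒conjugate-a≈0 : ∀ M → ¬ Scalar M → ∃[ G ] (det G ≈ 1# × M2.a (G · M · adj G) ≈ 0#)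
  non-scalar⇒conjugate-a≈0 M non-scalar =
    let G₁ , det-G₁≈1 , c₁≉0 = non-scalar⇒conjugate-c≉0 M non-scalar
        G₂ , det-G₂≈1 , a₂≈0 = c≉0⇒conjugate-a≈0 (G₁ · M · adj G₁) c₁≉0 in
    G₂ · G₁ , trans (det-· G₂ G₁) (trans (*-cong det-G₂≈1 det-G₁≈1) (*-identityˡ 1#)) ,
    trans (proj₁ (conj-conj G₂ G₁ M)) a₂≈0

module IntegersModulo (p : ℕ) where
  open import Level using (0ℓ)
  open import Data.Integer as ℤ using (ℤ; +_; _+_; _-_; _*_; -_; 0ℤ; 1ℤ)
  import Data.Integer.Properties as ℤ
  import Data.Integer.Divisibility.Signed as Signed
  open import Data.Integer.Tactic.RingSolver using (solve-∀)
  open import Data.Product using (_,_)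
  open import Relation.Binary.PropositionalEquality as ≡ using (_≡_)
  open import Defs using (𝔽)

  -- A record rather than 𝔽 p's relation itself, so that x and y can be inferred
  -- from a proof of x ≈ₚ y.
  infix 4 _≈ₚ_
  record _≈ₚ_ (x y : ℤ) : Set where
    constructor mod-p
    field unmod : RawRing._≈_ (𝔽 p) x y

  open _≈ₚ_ public

  private
    P = + p

    combine : ∀ {x y x′ y′ z z′} a b → z - z′ ≡ a * (x - y) + b * (x′ - y′) → x ≈ₚ y → x′ ≈ₚ y′ → z ≈ₚ z′
    combine a b eq (mod-p p∣x-y) (mod-p p∣x′-y′) = mod-p (Signed.∣⇒∣ᵤ (≡.subst (P Signed.∣_) (≡.sym eq)
      (Signed.∣m∣n⇒∣m+n (Signed.∣n⇒∣m*n a (Signed.∣ᵤ⇒∣ p∣x-y)) (Signed.∣n⇒∣m*n b (Signed.∣ᵤ⇒∣ p∣x′-y′)))))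

  ≈ₚ-refl : ∀ {x} → x ≈ₚ x
  ≈ₚ-refl {x} = mod-p (Signed.∣⇒∣ᵤ (≡.subst (P Signed.∣_) (≡.sym (ℤ.+-inverseʳ x)) (Signed.divides 0ℤ ≡.refl)))

  ≈ₚ-reflexive : ∀ {x y} → x ≡ y → x ≈ₚ y
  ≈ₚ-reflexive ≡.refl = ≈ₚ-refl

  private
    ≈ₚ-sym : ∀ {x y} → x ≈ₚ y → y ≈ₚ x
    ≈ₚ-sym {x} {y} x≈y = combine (- 1ℤ) 0ℤ (eq x y) x≈y x≈y
      where
      eq : ∀ x y → y - x ≡ - 1ℤ * (x - y) + 0ℤ * (x - y)
      eq = solve-∀

    ≈ₚ-trans : ∀ {x y z} → x ≈ₚ y → y ≈ₚ z → x ≈ₚ z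
    ≈ₚ-trans {x} {y} {z} = combine 1ℤ 1ℤ (eq x y z)
      where
      eq : ∀ x y z → x - z ≡ 1ℤ * (x - y) + 1ℤ * (y - z)
      eq = solve-∀

    +-cong : ∀ {x y u v} → x ≈ₚ y → u ≈ₚ v → x + u ≈ₚ y + v
    +-cong {x} {y} {u} {v} = combine 1ℤ 1ℤ (eq x y u v)
      where
      eq : ∀ x y u v → (x + u) - (y + v) ≡ 1ℤ * (x - y) + 1ℤ * (u - v)
      eq = solve-∀

    *-cong : ∀ {x y u v} → x ≈ₚ y → u ≈ₚ v → x * u ≈ₚ y * v
    *-cong {x} {y} {u} {v} = combine u y (eq x y u v)
      where
      eq : ∀ x y u v → x * u - y * v ≡ u * (x - y) + y * (u - v)
      eq = solve-∀

    -‿cong : ∀ {x y} → x ≈ₚ y → - x ≈ₚ - y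
    -‿cong {x} {y} x≈y = combine (- 1ℤ) 0ℤ (eq x y) x≈y x≈y
      where
      eq : ∀ x y → - x - - y ≡ - 1ℤ * (x - y) + 0ℤ * (x - y)
      eq = solve-∀

  ℤ/p : CommutativeRing 0ℓ 0ℓ
  ℤ/p = record
    { Carrier = ℤ ; _≈_ = _≈ₚ_ ; _+_ = _+_ ; _*_ = _*_ ; -_ = -_ ; 0# = 0ℤ ; 1# = 1ℤ
    ; isCommutativeRing = record
      { isRing = record
        { +-isAbelianGroup = record
          { isGroup = record
            { isMonoid = record
              { isSemigroup = record
                { isMagma = record
                  { isEquivalence = record { refl = ≈ₚ-refl ; sym = ≈ₚ-sym ; trans = ≈ₚ-trans }
                  ; ∙-cong = +-cong }
                ; assoc = λ x y z → ≈ₚ-reflexive (ℤ.+-assoc x y z) }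
              ; identity = (λ x → ≈ₚ-reflexive (ℤ.+-identityˡ x)) , (λ x → ≈ₚ-reflexive (ℤ.+-identityʳ x)) }
            ; inverse = (λ x → ≈ₚ-reflexive (ℤ.+-inverseˡ x)) , (λ x → ≈ₚ-reflexive (ℤ.+-inverseʳ x))
            ; ⁻¹-cong = -‿cong }
          ; comm = λ x y → ≈ₚ-reflexive (ℤ.+-comm x y) }
        ; *-cong = *-cong
        ; *-assoc = λ x y z → ≈ₚ-reflexive (ℤ.*-assoc x y z)
        ; *-identity = (λ x → ≈ₚ-reflexive (ℤ.*-identityˡ x)) , (λ x → ≈ₚ-reflexive (ℤ.*-identityʳ x))
        ; distrib = (λ x y z → ≈ₚ-reflexive (ℤ.*-distribˡ-+ x y z)) , (λ x y z → ≈ₚ-reflexive (ℤ.*-distribʳ-+ x y z)) }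
      ; *-comm = λ x y → ≈ₚ-reflexive (ℤ.*-comm x y) }
    }

module PrimeField {p : ℕ} (p-prime : Prime p) where
  open import Data.Nat as ℕ using (zero; suc; _∸_)
  import Data.Nat.Properties as ℕ
  open import Data.Nat.Divisibility as ℕ using (∣⇒≤)
  open import Data.Nat.Primality using (euclidsLemma; prime⇒nonZero; prime⇒nonTrivial)
  open import Data.Integer as ℤ using (ℤ; +_; _+_; _-_; _*_; _^_; 0ℤ; 1ℤ; ∣_∣)
  open import Data.Integer.Divisibility using (_∣_)
  import Data.Integer.Properties as ℤ
  open import Data.Integer.DivMod using (_%_; _/_; a≡a%n+[a/n]*n)
  import Data.Integer.Divisibility.Signed as Signed
  open import Data.Integer.Tactic.RingSolver using (solve-∀)
  open import Data.Product using (∃-syntax; _,_)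
  open import Data.Sum using (_⊎_; inj₁; inj₂)
  open import Data.Empty using (⊥-elim)
  open import Relation.Nullary using (¬_; Dec; yes; no)
  open import Relation.Binary.PropositionalEquality as ≡ using (_≡_)
  open import Defs using (natCast; Is𝔽Algebra; IsUnitModP)

  open IntegersModulo p public
  open CommutativeRing ℤ/p using (rawRing; setoid; +-cong; *-cong) renaming (refl to ≈-refl; sym to ≈-sym; trans to ≈-trans)
  open import Algebra.Properties.Semiring.Exp (CommutativeRing.semiring ℤ/p) as Exp using ()
  open import Algebra.Properties.Group (CommutativeRing.+-group ℤ/p) using (x∙y⁻¹≈ε⇒x≈y; x≈y⇒x∙y⁻¹≈ε)
  open Frobenius ℤ/p using (frobenius)
  open import Relation.Binary.Reasoning.Setoid setoid

  private
    P = + p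

    instance
      p≢0 = prime⇒nonZero p-prime

    p≡1+[p∸1] : p ≡ suc (p ∸ 1)
    p≡1+[p∸1] = ≡.sym (ℕ.suc-pred p)

  ≈ₚ0⇒∣ : ∀ {x} → x ≈ₚ 0ℤ → P ∣ x
  ≈ₚ0⇒∣ {x} (mod-p p∣x-0) = ≡.subst (P ∣_) (ℤ.+-identityʳ x) p∣x-0

  ∣⇒≈ₚ0 : ∀ {x} → P ∣ x → x ≈ₚ 0ℤ
  ∣⇒≈ₚ0 {x} p∣x = mod-p (≡.subst (P ∣_) (≡.sym (ℤ.+-identityʳ x)) p∣x)

  unit⇒≉0 : ∀ {u} → IsUnitModP p u → ¬ u ≈ₚ 0ℤ
  unit⇒≉0 p∤u u≈0 = p∤u (≈ₚ0⇒∣ u≈0)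

  1-unit : IsUnitModP p 1ℤ
  1-unit p∣1 = ℕ.<⇒≱ (ℕ.nonTrivial⇒n>1 p {{prime⇒nonTrivial p-prime}}) (∣⇒≤ p∣1)

  _≈ₚ?_ : ∀ x y → Dec (x ≈ₚ y)
  x ≈ₚ? y with p ℕ.∣? ∣ x - y ∣
  ... | yes p∣x-y = yes (mod-p p∣x-y)
  ... | no  p∤x-y = no (λ x≈y → p∤x-y (unmod x≈y))

  integral : ∀ {x y} → x * y ≈ₚ 0ℤ → x ≈ₚ 0ℤ ⊎ y ≈ₚ 0ℤ
  integral {x} {y} xy≈0 with euclidsLemma ∣ x ∣ ∣ y ∣ p-prime (≡.subst (p ℕ.∣_) (ℤ.abs-* x y) (≈ₚ0⇒∣ xy≈0))
  ... | inj₁ p∣x = inj₁ (∣⇒≈ₚ0 p∣x)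
  ... | inj₂ p∣y = inj₂ (∣⇒≈ₚ0 p∣y)

  ^-congˡ : ∀ {x y} n → x ≈ₚ y → x ^ n ≈ₚ y ^ n
  ^-congˡ zero    x≈y = ≈-refl
  ^-congˡ (suc n) x≈y = *-cong x≈y (^-congˡ n x≈y)

  private
    ^≡Exp^ : ∀ x n → x ^ n ≡ x Exp.^ n
    ^≡Exp^ x zero    = ≡.refl
    ^≡Exp^ x (suc n) = ≡.cong (λ m → x * m) (^≡Exp^ x n)

    natCast≡+ : ∀ n → natCast rawRing n ≡ + n
    natCast≡+ zero    = ≡.refl
    natCast≡+ (suc n) = ≡.cong (λ m → 1ℤ + m) (natCast≡+ n)

    char-p : Is𝔽Algebra ℤ/p p
    char-p = ≡.subst (_≈ₚ 0ℤ) (≡.sym (natCast≡+ p)) (∣⇒≈ₚ0 (ℕ.∣-refl))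

    x≈x%p : ∀ x → x ≈ₚ + (x % P)
    x≈x%p x = mod-p (Signed.∣⇒∣ᵤ (Signed.divides (x / P)
      (≡.trans (≡.cong (_- + (x % P)) (a≡a%n+[a/n]*n x P)) (r+m-r≡m (+ (x % P)) ((x / P) * P)))))
      where
      r+m-r≡m : ∀ r m → r + m - r ≡ m
      r+m-r≡m = solve-∀

    fermat-ℕ : ∀ n → (+ n) ^ p ≈ₚ + n
    fermat-ℕ zero    = ≈ₚ-reflexive (≡.subst (λ q → 0ℤ ^ q ≡ 0ℤ) (≡.sym p≡1+[p∸1]) ≡.refl)
    fermat-ℕ (suc n) = begin
      (1ℤ + + n) ^ p                ≡⟨ ^≡Exp^ (1ℤ + + n) p ⟩
      (1ℤ + + n) Exp.^ p            ≈⟨ frobenius p-prime char-p 1ℤ (+ n) ⟩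
      1ℤ Exp.^ p + (+ n) Exp.^ p    ≡⟨ ≡.cong₂ _+_ (≡.trans (≡.sym (^≡Exp^ 1ℤ p)) (ℤ.^-zeroˡ p)) (≡.sym (^≡Exp^ (+ n) p)) ⟩
      1ℤ + (+ n) ^ p                ≈⟨ +-cong (≈-refl {1ℤ}) (fermat-ℕ n) ⟩
      1ℤ + + n                      ∎

  fermat : ∀ x → x ^ p ≈ₚ x
  fermat x = ≈-trans (^-congˡ p (x≈x%p x)) (≈-trans (fermat-ℕ (x % P)) (≈-sym (x≈x%p x)))

  fermat-unit : ∀ {x} → ¬ x ≈ₚ 0ℤ → x ^ (p ∸ 1) ≈ₚ 1ℤ
  fermat-unit {x} x≉0 with integral x[x^[p-1]-1]≈0
    where
    x[x^[p-1]-1]≈0 : x * (x ^ (p ∸ 1) - 1ℤ) ≈ₚ 0ℤ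
    x[x^[p-1]-1]≈0 = begin
      x * (x ^ (p ∸ 1) - 1ℤ)   ≡⟨ distribute x (x ^ (p ∸ 1)) ⟩
      x * x ^ (p ∸ 1) - x      ≡⟨ ≡.cong (λ q → x ^ q - x) (≡.sym p≡1+[p∸1]) ⟩
      x ^ p - x                ≈⟨ x≈y⇒x∙y⁻¹≈ε (fermat x) ⟩
      0ℤ                       ∎
      where
      distribute : ∀ x y → x * (y - 1ℤ) ≡ x * y - x
      distribute = solve-∀
  ... | inj₁ x≈0              = ⊥-elim (x≉0 x≈0)
  ... | inj₂ x^[p-1]-1≈0      = x∙y⁻¹≈ε⇒x≈y _ _ x^[p-1]-1≈0

  inverse : ∀ {x} → ¬ x ≈ₚ 0ℤ → ∃[ y ] (x * y ≈ₚ 1ℤ)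
  inverse {x} x≉0 = x ^ (p ∸ 1 ∸ 1) , ≡.subst (λ q → x ^ q ≈ₚ 1ℤ) p∸1≡1+[p∸1∸1] (fermat-unit x≉0)
    where
    p∸1≡1+[p∸1∸1] : p ∸ 1 ≡ suc (p ∸ 1 ∸ 1)
    p∸1≡1+[p∸1∸1] = ≡.sym (ℕ.suc-pred (p ∸ 1) {{ℕ.>-nonZero (ℕ.m<n⇒0<n∸m (ℕ.nonTrivial⇒n>1 p {{prime⇒nonTrivial p-prime}}))}})

  ℤ/p-isIntegralDomain : IsIntegralDomain ℤ/p
  ℤ/p-isIntegralDomain = record { 1≉0 = unit⇒≉0 1-unit ; integral = integral }

  ℤ/p-isDiscreteField : IsDiscreteField ℤ/p
  ℤ/p-isDiscreteField = record { ≈0? = λ x → x ≈ₚ? 0ℤ ; inverse = inverse }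

module NonScalarElement {p : ℕ} (p-prime : Prime p) where
  open import Data.Nat as ℕ using (zero; suc; _∸_; _≤_)
  import Data.Nat.Properties as ℕ
  open import Data.Nat.Divisibility using (divides)
  open import Data.Nat.Primality using (prime⇒nonTrivial)
  open import Data.Nat.GCD using (gcd; gcd[m,n]∣m)
  open import Data.Nat.Tactic.RingSolver as ℕ-Solver using ()
  open import Data.Integer as ℤ using (ℤ; +_; _+_; _-_; _*_; _^_; 0ℤ; 1ℤ; -1ℤ)
  import Data.Integer.Properties as ℤ
  open import Data.Fin using (Fin)
  import Data.Fin.Properties as Fin
  open import Data.Vec using (Vec; _∷_; replicate)
  open import Data.Product using (∃-syntax; _×_; _,_)
  open import Data.Empty using (⊥-elim)
  open import Relation.Nullary using (¬_)
  open import Relation.Binary.PropositionalEquality as ≡ using (_≡_; _≢_)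
  open import Defs using (M2; mat; det; 𝔽; DetOnto; CardGT)

  open PrimeField p-prime
  open CommutativeRing ℤ/p using (refl; sym; trans; +-congˡ; +-cong; *-cong; *-congˡ; -‿cong; setoid)
  open FieldConjugation ℤ/p ℤ/p-isDiscreteField using (Scalar; Scalar?)
  open RootBound ℤ/p ℤ/p-isIntegralDomain using (monic; roots-bound)
  open IntegerCast ℤ/p using (solve; _:=_; _:+_; _:*_; :-_; con)
  open import Relation.Binary.Reasoning.Setoid setoid

  module _ (k s : ℕ) (s*gcd≡p∸1 : s ℕ.* gcd (k ∸ 1) (p ∸ 1) ≡ p ∸ 1) where

    [u^[k-1]]^s≈1 : ∀ {u} → ¬ u ≈ₚ 0ℤ → (u ^ (k ∸ 1)) ^ s ≈ₚ 1ℤ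
    [u^[k-1]]^s≈1 {u} u≉0 with gcd[m,n]∣m (k ∸ 1) (p ∸ 1)
    ... | divides t k∸1≡t*g = begin
      (u ^ (k ∸ 1)) ^ s       ≡⟨ ℤ.^-*-assoc u (k ∸ 1) s ⟩
      u ^ ((k ∸ 1) ℕ.* s)     ≡⟨ ≡.cong (u ^_) (≡.trans (≡.cong (ℕ._* s) k∸1≡t*g) (≡.trans (reorder t g s) (≡.cong (ℕ._* t) s*gcd≡p∸1))) ⟩
      u ^ ((p ∸ 1) ℕ.* t)     ≡⟨ ≡.sym (ℤ.^-*-assoc u (p ∸ 1) t) ⟩
      (u ^ (p ∸ 1)) ^ t       ≈⟨ ^-congˡ t (fermat-unit u≉0) ⟩
      1ℤ ^ t                  ≡⟨ ℤ.^-zeroˡ t ⟩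
      1ℤ                      ∎
      where
      g = gcd (k ∸ 1) (p ∸ 1)
      reorder : ∀ t g s → t ℕ.* g ℕ.* s ≡ s ℕ.* g ℕ.* t
      reorder = ℕ-Solver.solve-∀

    private
      monic-zeros : ∀ m x → monic (replicate m 0ℤ) x ≈ₚ x ^ m
      monic-zeros zero    x = refl
      monic-zeros (suc m) x = trans (≈ₚ-reflexive (ℤ.+-identityˡ _)) (*-congˡ {x} (monic-zeros m x))

      s≢0 : s ≢ 0
      s≢0 ≡.refl = ℕ.<⇒≢ (ℕ.m<n⇒0<n∸m (ℕ.nonTrivial⇒n>1 p {{prime⇒nonTrivial p-prime}})) s*gcd≡p∸1

      m = 2 ℕ.* s ∸ 1

      1+m≡2s : suc m ≡ 2 ℕ.* s
      1+m≡2s = lemma s s≢0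
        where
        lemma : ∀ t → t ≢ 0 → suc (2 ℕ.* t ∸ 1) ≡ 2 ℕ.* t
        lemma zero    t≢0 = ⊥-elim (t≢0 ≡.refl)
        lemma (suc t) _   = ≡.refl

      X^[1+m]-1 : Vec ℤ (suc m)
      X^[1+m]-1 = -1ℤ ∷ replicate m 0ℤ

      scalar⇒root : ∀ M {u} → Scalar M → ¬ u ≈ₚ 0ℤ → det (𝔽 p) M ≈ₚ u ^ (k ∸ 1) → monic X^[1+m]-1 (M2.a M) ≈ₚ 0ℤ
      scalar⇒root (mat a b c d) {u} (b≈0 , c≈0 , a≈d) u≉0 det≈u^[k-1] = begin
        -1ℤ + a * monic (replicate m 0ℤ) a   ≈⟨ +-congˡ { -1ℤ} (*-congˡ {a} (monic-zeros m a)) ⟩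
        -1ℤ + a ^ suc m                      ≡⟨ ≡.cong (λ n → -1ℤ + a ^ n) 1+m≡2s ⟩
        -1ℤ + a ^ (2 ℕ.* s)                  ≡⟨ ≡.cong (λ x → -1ℤ + x) (≡.sym (ℤ.^-*-assoc a 2 s)) ⟩
        -1ℤ + (a ^ 2) ^ s                    ≈⟨ +-congˡ { -1ℤ} (^-congˡ s a²≈u^[k-1]) ⟩
        -1ℤ + (u ^ (k ∸ 1)) ^ s              ≈⟨ +-congˡ { -1ℤ} ([u^[k-1]]^s≈1 u≉0) ⟩
        -1ℤ + 1ℤ                             ≈⟨ refl ⟩
        0ℤ                                   ∎
        where
        a²≈u^[k-1] : a ^ 2 ≈ₚ u ^ (k ∸ 1)
        a²≈u^[k-1] = begin
          a ^ 2                ≈⟨ solve 1 (λ a → a :* (a :* con (+ 1)) := a :* a :+ :- (con (+ 0) :* con (+ 0))) refl a ⟩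
          a * a - 0ℤ * 0ℤ      ≈⟨ +-cong (*-congˡ {a} a≈d) (-‿cong (*-cong (sym b≈0) (sym c≈0))) ⟩
          a * d - b * c        ≈⟨ det≈u^[k-1] ⟩
          u ^ (k ∸ 1)          ∎

    non-scalar-element : ∀ {H} → DetOnto p k H → CardGT p H (2 ℕ.* s) → ∃[ h ] (H h × ¬ Scalar h)
    non-scalar-element {H} (det-power , _) (f , f∈H , f-injective) =
      let i , f[i]-non-scalar = Fin.¬∀⟶∃¬ _ (λ i → Scalar (f i)) (λ i → Scalar? (f i)) not-all-scalar in
      f i , f∈H i , f[i]-non-scalar
      where
      not-all-scalar : ¬ (∀ i → Scalar (f i))
      not-all-scalar all-scalar = ℕ.<-irrefl ≡.refl (≡.subst (suc (2 ℕ.* s) ≤_) 1+m≡2s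
        (roots-bound X^[1+m]-1 (λ i → M2.a (f i)) is-root a-injective))
        where
        is-root : ∀ i → monic X^[1+m]-1 (M2.a (f i)) ≈ₚ 0ℤ
        is-root i = let u , u-unit , det≈u^[k-1] = det-power (f i) (f∈H i) in
          scalar⇒root (f i) (all-scalar i) (unit⇒≉0 u-unit) (mod-p det≈u^[k-1])
        a-injective : ∀ i j → M2.a (f i) ≈ₚ M2.a (f j) → i ≡ j
        a-injective i j aᵢ≈aⱼ =
          let bᵢ≈0 , cᵢ≈0 , aᵢ≈dᵢ = all-scalar i
              bⱼ≈0 , cⱼ≈0 , aⱼ≈dⱼ = all-scalar j in
          f-injective i j (unmod aᵢ≈aⱼ , unmod (trans bᵢ≈0 (sym bⱼ≈0)) , unmod (trans cᵢ≈0 (sym cⱼ≈0)) ,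
                           unmod (trans (sym aᵢ≈dᵢ) (trans aᵢ≈aⱼ aⱼ≈dⱼ)))

module Embedding {r ℓ} (R : CommutativeRing r ℓ) {p : ℕ} (char-p : Is𝔽Algebra R p) where
  open import Data.Integer as ℤ using (ℤ; +_)
  import Data.Integer.Divisibility.Signed as Signed
  open import Data.Integer.Tactic.RingSolver using (solve-∀)
  open import Data.Product using (_,_)
  open import Relation.Binary.PropositionalEquality as ≡ using (_≡_)
  open import Defs using (M2; mat; mapM2; InverseOf)

  open CommutativeRing R
  open IntegersModulo p using (_≈ₚ_; mod-p; ℤ/p)
  open IntegerCast R using (ι; ι-+; ι-*; ι-neg; ι-1; solve; _:=_; _:+_; _:*_; con)
  open Matrix R
  private module ℤ/p = Matrix ℤ/p
  open import Relation.Binary.Reasoning.Setoid setoid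

  ι-resp : ∀ {x y} → x ≈ₚ y → ι x ≈ ι y
  ι-resp {x} {y} (mod-p p∣x-y) with Signed.∣ᵤ⇒∣ {+ p} {x ℤ.- y} p∣x-y
  ... | Signed.divides q x-y≡q*p = begin
    ι x                      ≡⟨ ≡.cong ι (x≡[x-y]+y x y) ⟩
    ι ((x ℤ.- y) ℤ.+ y)      ≈⟨ ι-+ (x ℤ.- y) y ⟩
    ι (x ℤ.- y) + ι y        ≡⟨ ≡.cong (λ z → ι z + ι y) x-y≡q*p ⟩
    ι (q ℤ.* + p) + ι y      ≈⟨ +-congʳ (trans (ι-* q (+ p)) (*-congˡ char-p)) ⟩
    ι q * 0# + ι y           ≈⟨ solve 2 (λ a b → a :* con (+ 0) :+ b := b) refl (ι q) (ι y) ⟩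
    ι y                      ∎
    where
    x≡[x-y]+y : ∀ x y → x ≡ (x ℤ.- y) ℤ.+ y
    x≡[x-y]+y = solve-∀

  embed : M2 ℤ → Mx
  embed = mapM2 ι

  embed-resp : ∀ {M N} → M ℤ/p.≋ N → embed M ≋ embed N
  embed-resp {mat _ _ _ _} {mat _ _ _ _} (a≈ , b≈ , c≈ , d≈) = ι-resp a≈ , ι-resp b≈ , ι-resp c≈ , ι-resp d≈

  embed-· : ∀ M N → embed (M ℤ/p.· N) ≋ embed M · embed N
  embed-· (mat a b c d) (mat e f g h) = entry a e b g , entry a f b h , entry c e d g , entry c f d h
    where
    entry : ∀ a b c d → ι (a ℤ.* b ℤ.+ c ℤ.* d) ≈ ι a * ι b + ι c * ι d
    entry a b c d = trans (ι-+ (a ℤ.* b) (c ℤ.* d)) (+-cong (ι-* a b) (ι-* c d))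

  embed-adj : ∀ M → embed (ℤ/p.adj M) ≋ adj (embed M)
  embed-adj (mat a b c d) = refl , ι-neg b , ι-neg c , refl

  embed-I : embed ℤ/p.I ≋ I
  embed-I = ι-1 , refl , refl , ι-1

  embed-det : ∀ M → det (embed M) ≈ ι (ℤ/p.det M)
  embed-det (mat a b c d) = sym (trans (ι-+ (a ℤ.* d) (ℤ.- (b ℤ.* c))) (+-cong (ι-* a d) (trans (ι-neg (b ℤ.* c)) (-‿cong (ι-* b c)))))

  embed-inverse : ∀ {M N} → InverseOf (CommutativeRing.rawRing ℤ/p) N M → InverseOf rawRing (embed N) (embed M)
  embed-inverse {M} {N} (MN≋I , NM≋I) =
    ≋-trans (≋-sym (embed-· M N)) (≋-trans (embed-resp MN≋I) embed-I) ,
    ≋-trans (≋-sym (embed-· N M)) (≋-trans (embed-resp NM≋I) embed-I)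

  embed-conj : ∀ G X → embed (G ℤ/p.· X ℤ/p.· ℤ/p.adj G) ≋ embed G · embed X · adj (embed G)
  embed-conj G X = ≋-trans (embed-· (G ℤ/p.· X) (ℤ/p.adj G)) (·-cong (embed-· G X) (embed-adj G))

module NormalClosureInĜ {r ℓ} {p : ℕ} (p-prime : Prime p) (k : ℕ) (R : CommutativeRing r ℓ) (char-p : Is𝔽Algebra R p)
  {H : M2 ℤ → Set} (H≤GL₂ : IsSubgroupGL2 p H) where
  open import Data.Nat as ℕ using (_≤_; s≤s; z≤n)
  import Data.Nat.Properties as ℕ
  open import Data.Nat.Divisibility using (∣⇒≤)
  open import Data.Integer as ℤ using (+_; 0ℤ; 1ℤ)
  open import Data.Product using (∃-syntax; _×_; _,_; proj₁; proj₂)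
  open import Relation.Nullary using (¬_)
  open import Defs using (𝔽; _≈M_; InverseOf; NormalClosure; DetOnto)

  open CommutativeRing R
  open PrimeField p-prime
  open FieldConjugation ℤ/p ℤ/p-isDiscreteField using (Scalar; non-scalar⇒conjugate-a≈0)
  open IntegerCast R using (ι; ι-*; ι-1; solve; _:=_; _:+_; con)
  open Matrix R
  private module ℤ/p = Matrix ℤ/p
  open Embedding R {p} char-p
  open NormalClosureProperties p k R H 1-unit
  open ElementaryGeneration p k R H 1-unit
  open IsSubgroupGL2 H≤GL₂
  open NormalClosure

  private
    ≈M⇒≋ : ∀ {M N} → _≈M_ (𝔽 p) M N → M ℤ/p.≋ N
    ≈M⇒≋ (a≈ , b≈ , c≈ , d≈) = mod-p a≈ , mod-p b≈ , mod-p c≈ , mod-p d≈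

    inverse-in-ℤ/p : ∀ {h} → H h → ∃[ h′ ] (InverseOf (CommutativeRing.rawRing ℤ/p) h′ h)
    inverse-in-ℤ/p {h} h∈H = let h′ , hh′≈I , h′h≈I = H-sub h h∈H in h′ , ≈M⇒≋ hh′≈I , ≈M⇒≋ h′h≈I

  ι-unit : ∀ {x} → ¬ x ≈ₚ 0ℤ → ∃[ y ] (ι x * y ≈ 1#)
  ι-unit {x} x≉0 = let y , xy≈1 = inverse x≉0 in ι y , trans (sym (ι-* x y)) (trans (ι-resp xy≈1) ι-1)

  non-scalar⇒[E₂₁,E₁₂]∈N : ∀ {h} → H h → ¬ Scalar h → ∀ y u → N [ E₂₁ y , E₁₂ u ]
  non-scalar⇒[E₂₁,E₁₂]∈N {h} h∈H non-scalar =
    let G , det-G≈1 , a≈0 = non-scalar⇒conjugate-a≈0 h non-scalar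
        h′ , h-inv = inverse-in-ℤ/p h∈H
        det-embed-G≈1 : det (embed G) ≈ 1#
        det-embed-G≈1 = trans (embed-det G) (trans (ι-resp {ℤ/p.det G} {1ℤ} det-G≈1) ι-1)
    in [E₂₁,E₁₂]∈N (N-conj det-embed-G≈1 (embed∈N h∈H)) (conj-inverse det-embed-G≈1 (embed-inverse {h} {h′} h-inv))
         (trans (sym (proj₁ (embed-conj G h))) (ι-resp a≈0))

  SL₂⊆N⇒Ĝ⊆N : DetOnto p k H → (∀ M → det M ≈ 1# → N M) → ∀ γ → Ĝ γ → N γ
  SL₂⊆N⇒Ĝ⊆N (_ , det-onto) SL₂⊆N γ (_ , u , u-unit , det-γ≈u^[k-1]) with det-onto u u-unit
  ... | h , h∈H , det-h≈u^[k-1] with inverse-in-ℤ/p h∈H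
  ...   | h′ , hh′≋I , h′h≋I =
    resp _ _ (mul _ _ (SL₂⊆N (γ · embed h′) det-γh′≈1) (embed∈N h∈H)) γh′h≋γ
    where
    u^[k-1]·det-h′≈1 : u ℤ.^ (k ℕ.∸ 1) ℤ.* ℤ/p.det h′ ≈ₚ 1ℤ
    u^[k-1]·det-h′≈1 = ℤ/pᴿ.trans (ℤ/pᴿ.*-congʳ (ℤ/pᴿ.sym det-h≈u^[k-1]′)) (ℤ/p.det-inverse {h} {h′} hh′≋I)
      where
      module ℤ/pᴿ = CommutativeRing ℤ/p
      det-h≈u^[k-1]′ : ℤ/p.det h ≈ₚ u ℤ.^ (k ℕ.∸ 1)
      det-h≈u^[k-1]′ = mod-p det-h≈u^[k-1]
    det-γh′≈1 : det (γ · embed h′) ≈ 1#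
    det-γh′≈1 = begin
      det (γ · embed h′)                      ≈⟨ det-· γ (embed h′) ⟩
      det γ * det (embed h′)                  ≈⟨ *-cong det-γ≈u^[k-1] (embed-det h′) ⟩
      ι (u ℤ.^ (k ℕ.∸ 1)) * ι (ℤ/p.det h′)    ≈⟨ sym (ι-* (u ℤ.^ (k ℕ.∸ 1)) (ℤ/p.det h′)) ⟩
      ι (u ℤ.^ (k ℕ.∸ 1) ℤ.* ℤ/p.det h′)      ≈⟨ ι-resp u^[k-1]·det-h′≈1 ⟩
      ι 1ℤ                                    ≈⟨ ι-1 ⟩
      1#                                      ∎
      where open import Relation.Binary.Reasoning.Setoid setoid
    γh′h≋γ : γ · embed h′ · embed h ≋ γ
    γh′h≋γ = ≋-trans (·-assoc γ _ _)
      (≋-trans (·-congˡ (≋-trans (≋-sym (embed-· h′ h)) (≋-trans (embed-resp h′h≋I) embed-I))) (·-identityʳ γ))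

  module _ (5≤p : 5 ≤ p) where
    private
      ι-unit-below-p : ∀ n → 0 ℕ.< n → n ℕ.< p → ∃[ y ] (ι (+ n) * y ≈ 1#)
      ι-unit-below-p n 0<n n<p = ι-unit {+ n} (λ n≈0 → ℕ.<⇒≱ n<p (∣⇒≤ {{ℕ.>-nonZero 0<n}} (≈ₚ0⇒∣ n≈0)))

    2-unit : ∃[ y ] ((1# + 1#) * y ≈ 1#)
    2-unit = let y , 2y≈1 = ι-unit-below-p 2 (s≤s z≤n) (ℕ.≤-trans (s≤s (s≤s (s≤s z≤n))) 5≤p) in
      y , trans (*-congʳ (solve 0 (con (+ 1) :+ con (+ 1) := con (+ 2)) refl)) 2y≈1

    3-unit : ∃[ y ] ((1# + 1# + 1#) * y ≈ 1#)
    3-unit = let y , 3y≈1 = ι-unit-below-p 3 (s≤s z≤n) (ℕ.≤-trans (s≤s (s≤s (s≤s (s≤s z≤n)))) 5≤p) in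
      y , trans (*-congʳ (solve 0 (con (+ 1) :+ con (+ 1) :+ con (+ 1) := con (+ 3)) refl)) 3y≈1

    Ĝ⊆N : DetOnto p k H → ∃[ h ] (H h × ¬ Scalar h) →
          (∀ M → det M ≈ 1# → ∃[ t ] ∃[ v ] ((M2.a M + t * M2.c' M) * v ≈ 1#)) →
          ∀ γ → Ĝ γ → N γ
    Ĝ⊆N det-onto (h , h∈H , non-scalar) shift-unit = SL₂⊆N⇒Ĝ⊆N det-onto SL₂⊆N′
      where
      SL₂⊆N′ : ∀ M → det M ≈ 1# → N M
      SL₂⊆N′ M det≈1 = let t , v , [a+tc]v≈1 = shift-unit M det≈1 in
        SL₂⊆N (non-scalar⇒[E₂₁,E₁₂]∈N h∈H non-scalar) (proj₂ 2-unit) (proj₂ 3-unit) M det≈1 [a+tc]v≈1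

open import Data.Nat using (_≤_; _*_; _∸_)
open import Data.Nat.GCD using (gcd)
open import Data.Fin using (Fin)
open import Relation.Binary.PropositionalEquality using (_≡_; subst; sym)
open import Defs

propositionA1p1 : ∀ {c ℓ} (p : ℕ) → Prime p → 5 ≤ p →
    (k : ℕ) → 1 ≤ k →
    (r : ℕ) (A : Fin r → CommutativeRing c ℓ) →
    (∀ i → IsLocal (A i)) → (∀ i → Is𝔽Algebra (A i) p) →
    (s : ℕ) → s * gcd (k ∸ 1) (p ∸ 1) ≡ p ∸ 1 →
    (H : M2 ℤ → Set) → IsSubgroupGL2 p H →
    CardGT p H (2 * s) → DetOnto p k H →
    ∀ γ → InGhat p k (Prod r A) γ → NormalClosure p k (Prod r A) H γ
propositionA1p1 p p-prime 5≤p k _ r A local 𝔽-algebra s s*gcd≡p∸1 H H≤GL₂ |H|>2s det-onto =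
  Ĝ⊆N 5≤p det-onto (non-scalar-element k s s*gcd≡p∸1 det-onto |H|>2s) (det≈1⇒shift-unit A local)
  where
  open IndexedProduct A using (Π-commutativeRing; natCast-Π)
  open ProductOfLocalRings using (det≈1⇒shift-unit)
  open NonScalarElement p-prime using (non-scalar-element)
  char-p : Is𝔽Algebra Π-commutativeRing p
  char-p i = subst (λ x → CommutativeRing._≈_ (A i) x (CommutativeRing.0# (A i))) (sym (natCast-Π p i)) (𝔽-algebra i)
  open NormalClosureInĜ p-prime k Π-commutativeRing char-p H≤GL₂ using (Ĝ⊆N)
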